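{- Let $(G,\pi_0)$ be a colored graph. If some proof for $(G,\pi_0)$ (in the proof system described in the context) derives the fact $C(G,\pi_0)=(G',\pi')$, then $(G',\pi')$ is the canonical form $C(G,\pi_0)$ of $(G,\pi_0)$.
   Context: Graphs and colorings: $G=(V,E)$ is a finite undirected graph with $V=\{1,\dots,n\}$. A coloring of $G$ is a surjective map $\pi:V\to\{1,\dots,m\}$. The set $\pi^{ -1}(k)$ is its $k$-th cell. $\pi$ is identified with the ordered sequence of its cells $\pi^{ -1}(1),\dots,\pi^{ -1}(m)$, and $(G,\pi)$ is called a colored graph. The relation $\pi'\preceq\pi$ means that $\pi(u)<\pi(v)$ implies $\pi'(u)<\pi'(v)$ for all $u,v$. The relation $\pi'\prec\pi$ means $\pi'\preceq\pi$ and $\pi'\ne\pi$. A coloring is discrete if all its cells are singletons; a discrete coloring is a permutation of $V$. A permutation $\sigma$ of $V$ acts as follows: - $G^\sigma=(V,\{(u^\sigma,v^\sigma):(u,v)\in E\})$; - $\pi^\sigma(v^\sigma)=\pi(v)$, so the cells of $\pi^\sigma$ are the images of the cells of $\pi$, in the same order; - on vertex sets and vertex sequences, elementwise. $Aut(G,\pi)$ is the set of permutations $\sigma$ with $G^\sigma=G$ and $\pi^\sigma=\pi$. For a discrete coloring $\pi$, viewed as a permutation, $G^\pi$ and $\pi_0^\pi$ denote the images under it. For a vertex sequence $\nu=[v_1,\dots,v_k]$ we write $|\nu|=k$, $[\nu]_i=[v_1,\dots,v_i]$ and $[\nu,w]=[v_1,\dots,v_k,w]$; $<_{lex}$ is the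 lexicographic order. Refinement: the procedure make\_equitable$(G,\pi,\alpha)$, with $\alpha$ a list of cells of $\pi$, works as follows. Set $\pi':=\pi$. While $\pi'$ is not discrete and $\alpha\neq\emptyset$: 1. Let $W$ be the cell of $\pi'$ that belongs to $\alpha$ and comes first in $\pi'$. Remove $W$ from $\alpha$. 2. For each non-singleton cell $X$ of $\pi'$: - partition $X$ into the classes $X_1,\dots,X_k$ of vertices with equal numbers of neighbours in $W$, ordered by increasing number of neighbours in $W$; - let $j$ be the smallest index with $|X_j|$ maximal; - replace $X$ in place in $\pi'$ by $X_1,\dots,X_{j-1},X_{j+1},\dots,X_k,X_j$; - add each $X_i$ ($i\ne j$) to $\alpha$, and if $X\in\alpha$, replace it in $\alpha$ by $X_j$. Return $\pi'$. The refinement function $\bar R$ is defined recursively: - $\bar R(G,\pi_0,[\,])=$ make\_equitable$(G,\pi_0,\text{all cells of }\pi_0)$; - $\bar R(G,\pi_0,[\nu',v])$: let $\pi'=\bar R(G,\pi_0,\nu')$, let $\pi''$ be $\pi'$ with the cell $W\ni v$ replaced in place by $\{v\},W\setminus\{v\}$, and return make\_equitable$(G,\pi'',[\{v\}])$. Search tree: $\bar T(G,\pi_0,\nu)$ is the first non-singleton cell of $\bar R(G,\pi_0,\nu)$, or $\emptyset$ if $\bar R(G,\pi_0,\nu)$ is discrete. The search tree $\mathcal T(G,\pi_0)$ has root $[\,]$; the children of a node $\nu$ are $[\nu,w]$ for $w\in\bar T(G,\pi_0,\nu)$, in increasing order of $w$. The leaves are the nodes $\nu$ with $\bar R(G,\pi_0,\nu)$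 discrete, and for a leaf $\nu$ we set $G_\nu=G^{\bar R(G,\pi_0,\nu)}$. Invariants: fix a function hash from colored graphs to a totally ordered set with hash$(G^\sigma,\pi^\sigma)=$hash$(G,\pi)$ for every permutation $\sigma$. Define $\bar\phi(G,\pi_0,[v_1,\dots,v_k])=[h_1,\dots,h_k]$ with $h_i=$hash$(G,\bar R(G,\pi_0,[v_1,\dots,v_i]))$. Invariants are compared lexicographically, a proper prefix being smaller. Canonical form: fix a total order on graphs with vertex set $V$. A maximal leaf is a leaf whose invariant is maximal among all leaves. Let $G_{max}$ be the largest $G_\nu$ over maximal leaves. The canonical leaf $\nu^*$ is the lexicographically smallest maximal leaf with $G_{\nu^*}=G_{max}$. With $\pi^*=\bar R(G,\pi_0,\nu^*)$, the canonical form is $C(G,\pi_0)=(G^{\pi^*},\pi_0^{\pi^*})$. Proof system for a fixed $(G,\pi_0)$. Facts are the following formal expressions: - $\bar R(G,\pi_0,\nu)=\pi$; - $\bar R(G,\pi_0,\nu)\preceq\pi$; - $\bar T(G,\pi_0,\nu)=W$; - $\Omega\vartriangleleft\operatorname{orbits}(G,\pi_0,\nu)$; - $\bar\phi(G,\pi_0,\nu')=\bar\phi(G,\pi_0,\nu'')$; - $\operatorname{pruned}(G,\pi_0,\nu)$; - $\operatorname{on\_path}(G,\pi_0,\nu)$; - $C(G,\pi_0)=(G',\pi')$. Auxiliary functions: - $\operatorname{ind}(\pi,v)$ replaces the cell $W\ni v$ in place by $\{v\},W\setminus\{v\}$; - $\operatorname{split}(G,\pi,i)$ replaces each cell $X$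 of $\pi$ by the fragments $X_1,\dots,X_k$ of vertices with equal numbers of neighbours in the $i$-th cell of $\pi$, sorted ascending by that number, with the first fragment of maximal size moved to the end; - $\operatorname{cell}_j(\pi)$ is the $j$-th cell of $\pi$; - $\operatorname{discrete}(\pi)$ says that $\pi$ is discrete. A proof is a finite sequence of rule applications; each rule's premises must be conclusions of earlier applications, and its side conditions must hold. The rules (premises $\Rightarrow$ conclusion [side condition]), with $G,\pi_0$ fixed and omitted: - ColoringAxiom: $\Rightarrow \bar R([\,])\preceq\pi_0$. - Individualize: $\bar R(\nu)=\pi \Rightarrow \bar R([\nu,v])\preceq\operatorname{ind}(\pi,v)$. - SplitColoring: $\bar R(\nu)\preceq\pi\Rightarrow\bar R(\nu)\preceq\operatorname{split}(G,\pi,i)$, where $i=\min\{j:\operatorname{split}(G,\pi,j)\prec\pi\}$ [such $j$ exists]. - Equitable: $\bar R(\nu)\preceq\pi\Rightarrow\bar R(\nu)=\pi$ [$\operatorname{split}(G,\pi,i)=\pi$ for all $i$]. - TargetCell: $\bar R(\nu)=\pi\Rightarrow\bar T(\nu)=\operatorname{cell}_i(\pi)$, where $i=\min\{j:|\operatorname{cell}_j(\pi)|>1\}$ [such $j$ exists]. - InvariantAxiom: $\Rightarrow\bar\phi(\nu)=\bar\phi(\nu)$. - InvariantsEqual: $\bar\phi(\nu')=\bar\phi(\nu'')$, $\bar R([\nu',v'])=\pi_1$, $\bar R([\nu'',v''])=\pi_2\Rightarrow\bar\phi([\nu',v'])=\bar\phi([\nu'',v''])$ [hash$(G,\pi_1)=$hash$(G,\pi_2)$].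 - InvariantsEqualSym: $\bar\phi(\nu')=\bar\phi(\nu'')\Rightarrow\bar\phi(\nu'')=\bar\phi(\nu')$. - OrbitsAxiom: $\Rightarrow\{v\}\vartriangleleft\operatorname{orbits}(\nu)$. - MergeOrbits: $\Omega_1\vartriangleleft\operatorname{orbits}(\nu)$, $\Omega_2\vartriangleleft\operatorname{orbits}(\nu)\Rightarrow\Omega_1\cup\Omega_2\vartriangleleft\operatorname{orbits}(\nu)$ [there are $\sigma\in Aut(G,\pi_0)$ with $\nu^\sigma=\nu$, $w_1\in\Omega_1$ and $w_2\in\Omega_2$ with $w_1^\sigma=w_2$]. - PruneInvariant: $\bar\phi(\nu')=\bar\phi(\nu'')$, $\bar R([\nu',v'])=\pi_1$, $\bar R([\nu'',v''])=\pi_2\Rightarrow\operatorname{pruned}([\nu'',v''])$ [hash$(G,\pi_1)>$hash$(G,\pi_2)$]. - PruneLeaf: $\bar R(\nu')=\pi_1$, $\bar R(\nu'')=\pi_2$, $\bar\phi(\nu')=\bar\phi(\nu'')\Rightarrow\operatorname{pruned}(\nu'')$ [$\pi_2$ discrete, and ($\pi_1$ not discrete or $G^{\pi_1}>G^{\pi_2}$)]. - PruneAutomorphism: $\Rightarrow\operatorname{pruned}(\nu'')$ [there are $\nu'<_{lex}\nu''$ and $\sigma\in Aut(G,\pi_0)$ with $\nu'^\sigma=\nu''$]. - PruneOrbits: $\Omega\vartriangleleft\operatorname{orbits}(\nu)\Rightarrow\operatorname{pruned}([\nu,w_2])$ [$w_2\in\Omega$ and some $w_1\in\Omega$ has $w_1<w_2$].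 - PruneParent: $\bar T(\nu)=W$ and $\operatorname{pruned}([\nu,w])$ for all $w\in W\Rightarrow\operatorname{pruned}(\nu)$. - PathAxiom: $\Rightarrow\operatorname{on\_path}([\,])$. - ExtendPath: $\operatorname{on\_path}(\nu)$, $\bar T(\nu)=W$, $\operatorname{pruned}([\nu,w'])$ for all $w'\in W\setminus\{w\}\Rightarrow\operatorname{on\_path}([\nu,w])$. - CanonicalLeaf: $\operatorname{on\_path}(\nu)$, $\bar R(\nu)=\pi\Rightarrow C(G,\pi_0)=(G^\pi,\pi_0^\pi)$ [$\pi$ discrete]. -}

module Defs where

open import Level using (0ℓ)
open import Data.Bool using (Bool; true; false; _∧_; _∨_; not; if_then_else_; T)
open import Data.Nat using (ℕ; zero; suc; _+_; _*_; _<_; _≤_; _≡ᵇ_; _⊔_)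
open import Data.Fin using (Fin; toℕ)
open import Data.Fin.Subset using (Subset; ∣_∣; ⁅_⁆; _∩_; _∪_; _-_)
open import Data.Fin.Permutation using (Permutation′; _⟨$⟩ʳ_; _⟨$⟩ˡ_)
open import Data.Vec using (Vec; []; _∷_; lookup; tabulate)
open import Data.List using (List; []; _∷_; _++_; map; concatMap; foldl; foldr; length; upTo; [_]; _∷ʳ_)
open import Data.List.Relation.Unary.All using (All)
open import Data.List.Relation.Binary.Lex.Core using (Lex-<)
open import Data.Maybe using (Maybe; just; nothing)
open import Data.Product using (_×_; ∃; ∃-syntax; Σ-syntax; _,_)
open import Data.Sum using (_⊎_)
open import Relation.Nullary using (¬_)
open import Relation.Binary.PropositionalEquality using (_≡_; _≢_)

-- Graphs, vertex sets, colorings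
-- Vertices are Fin n (V = {1..n} shifted to 0-based).

Graph : ℕ → Set
Graph n = Vec (Vec Bool n) n

adj : ∀ {n} → Graph n → Fin n → Fin n → Bool
adj G u v = lookup (lookup G u) v

Undirected : ∀ {n} → Graph n → Set
Undirected G = ∀ u v → adj G u v ≡ adj G v u

mem : ∀ {n} → Subset n → Fin n → Bool
mem S v = lookup S v

-- A coloring is the ordered sequence of its cells (colour k+1 = k-th cell).
Coloring : ℕ → Set
Coloring n = List (Subset n)

cellsContaining : ∀ {n} → Coloring n → Fin n → ℕ
cellsContaining []       v = 0
cellsContaining (S ∷ π) v = (if mem S v then 1 else 0) + cellsContaining π v

-- a surjective map V → {1..m}: cells nonempty and partitioning V
IsColoring : ∀ {n} → Coloring n → Set
IsColoring π = All (λ S → 1 ≤ ∣ S ∣) π × (∀ v → cellsContaining π v ≡ 1)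

-- π(v) (0-based): index of the cell containing v
col : ∀ {n} → Coloring n → Fin n → ℕ
col []       v = 0
col (S ∷ π) v = if mem S v then 0 else suc (col π v)

_⪯_ : ∀ {n} → Coloring n → Coloring n → Set
π' ⪯ π = ∀ u v → col π u < col π v → col π' u < col π' v

_≺_ : ∀ {n} → Coloring n → Coloring n → Set
π' ≺ π = π' ⪯ π × π' ≢ π

discreteᵇ : ∀ {n} → Coloring n → Bool
discreteᵇ []       = true
discreteᵇ (S ∷ π) = (∣ S ∣ ≡ᵇ 1) ∧ discreteᵇ π

Discrete : ∀ {n} → Coloring n → Set
Discrete π = T (discreteᵇ π)

emptySet : ∀ {n} → Subset n
emptySet = tabulate (λ _ → false)

-- cell_i(π), 0-based; the empty set if i is out of range
cellAt : ∀ {n} → Coloring n → ℕ → Subset n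
cellAt []       i       = emptySet
cellAt (S ∷ π) zero    = S
cellAt (S ∷ π) (suc i) = cellAt π i

eqSubset : ∀ {n} → Subset n → Subset n → Bool
eqSubset []      []      = true
eqSubset (a ∷ s) (b ∷ t) = (if a then b else not b) ∧ eqSubset s t

elemᵇ : ∀ {n} → Subset n → List (Subset n) → Bool
elemᵇ S []       = false
elemᵇ S (X ∷ xs) = eqSubset S X ∨ elemᵇ S xs

removeAll : ∀ {n} → Subset n → List (Subset n) → List (Subset n)
removeAll S []       = []
removeAll S (X ∷ xs) = if eqSubset S X then removeAll S xs else X ∷ removeAll S xs

deg : ∀ {n} → Graph n → Subset n → Fin n → ℕ
deg G W v = ∣ W ∩ lookup G v ∣

keepNonempty : ∀ {n} → List (Subset n) → List (Subset n)
keepNonempty []       = []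
keepNonempty (S ∷ xs) = if ∣ S ∣ ≡ᵇ 0 then keepNonempty xs else S ∷ keepNonempty xs

-- X_1, …, X_k : classes of equal degree into W, by increasing degree
fragmentsAsc : ∀ {n} → Graph n → Subset n → Subset n → List (Subset n)
fragmentsAsc {n} G W X =
  keepNonempty (map (λ d → tabulate (λ v → mem X v ∧ (deg G W v ≡ᵇ d))) (upTo (suc n)))

maxSize : ∀ {n} → List (Subset n) → ℕ
maxSize = foldr (λ S m → ∣ S ∣ ⊔ m) 0

pickFirst : ∀ {n} → ℕ → List (Subset n) → List (Subset n) × Maybe (Subset n)
pickFirst m [] = [] , nothing
pickFirst m (S ∷ xs) with ∣ S ∣ ≡ᵇ m
... | true  = xs , just S
... | false with pickFirst m xs
...   | rest , r = S ∷ rest , r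

-- X_1..X_{j-1}, X_{j+1}..X_k   (j = first index of maximal size)
others : ∀ {n} → Graph n → Subset n → Subset n → List (Subset n)
others G W X with pickFirst (maxSize (fragmentsAsc G W X)) (fragmentsAsc G W X)
... | rest , _ = rest

-- X_j  (X itself in the degenerate case X = ∅)
largest : ∀ {n} → Graph n → Subset n → Subset n → Subset n
largest G W X with pickFirst (maxSize (fragmentsAsc G W X)) (fragmentsAsc G W X)
... | _ , just Y  = Y
... | _ , nothing = X

reordered : ∀ {n} → Graph n → Subset n → Subset n → List (Subset n)
reordered G W X = others G W X ++ [ largest G W X ]

-- split every cell of π w.r.t. W (singleton cells are left unchanged by this)
splitBy : ∀ {n} → Graph n → Subset n → Coloring n → Coloring n
splitBy G W π = concatMap (reordered G W) π

-- split(G, π, i), i 0-based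
split : ∀ {n} → Graph n → Coloring n → ℕ → Coloring n
split G π i = splitBy G (cellAt π i) π

firstIn : ∀ {n} → Coloring n → List (Subset n) → Maybe (Subset n)
firstIn []       α = nothing
firstIn (X ∷ π) α = if elemᵇ X α then just X else firstIn π α

-- the while loop, with fuel; the loop provably performs at most 2n
-- iterations (|α| ≤ n initially, at most n-1 cells ever added), so the
-- fuel 3n+1 is never exhausted.
meLoop : ∀ {n} → ℕ → Graph n → Coloring n → List (Subset n) → Coloring n
meLoop zero    G π α = π
meLoop (suc k) G π α with discreteᵇ π | firstIn π α
... | true  | _       = π
... | false | nothing = π
... | false | just W  =
  let α₁ = removeAll W α in
  meLoop k G (splitBy G W π) (map (largest G W) α₁ ++ concatMap (others G W) π)

make-equitable : ∀ {n} → Graph n → Coloring n → List (Subset n) → Coloring n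
make-equitable {n} G π α = meLoop (suc (3 * n)) G π α

-- ind(π, v): the cell W ∋ v replaced in place by {v}, W∖{v}
-- (a singleton cell {v} is left as it is, so that no empty cell arises)
ind : ∀ {n} → Coloring n → Fin n → Coloring n
ind π v = concatMap (λ S → if mem S v then (if ∣ S ∣ ≡ᵇ 1 then [ S ] else ⁅ v ⁆ ∷ [ S - v ]) else [ S ]) π

actG : ∀ {n} → Permutation′ n → Graph n → Graph n
actG σ G = tabulate (λ i → tabulate (λ j → adj G (σ ⟨$⟩ˡ i) (σ ⟨$⟩ˡ j)))

actS : ∀ {n} → Permutation′ n → Subset n → Subset n
actS σ S = tabulate (λ i → mem S (σ ⟨$⟩ˡ i))

actC : ∀ {n} → Permutation′ n → Coloring n → Coloring n
actC σ π = map (actS σ) π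

actν : ∀ {n} → Permutation′ n → List (Fin n) → List (Fin n)
actν σ ν = map (σ ⟨$⟩ʳ_) ν

Aut : ∀ {n} → Graph n → Coloring n → Permutation′ n → Set
Aut G π σ = actG σ G ≡ G × actC σ π ≡ π

-- Action of a discrete coloring π viewed as the permutation v ↦ π(v):
-- π⁻¹(i) is the unique element of cell i.
firstMem : ∀ {n} → Subset n → Maybe (Fin n)
firstMem []          = nothing
firstMem (true ∷ s)  = just Fin.zero
  where import Data.Fin as Fin
firstMem (false ∷ s) = Data.Maybe.map Fin.suc (firstMem s)
  where import Data.Fin as Fin
        import Data.Maybe

elemOr : ∀ {n} → Subset n → Fin n → Fin n
elemOr S d with firstMem S
... | just v  = v
... | nothing = d

discInv : ∀ {n} → Coloring n → Fin n → Fin n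
discInv π i = elemOr (cellAt π (toℕ i)) i

graphBy : ∀ {n} → Coloring n → Graph n → Graph n
graphBy π G = tabulate (λ i → tabulate (λ j → adj G (discInv π i) (discInv π j)))

colBy : ∀ {n} → Coloring n → Coloring n → Coloring n
colBy π π₀ = map (λ S → tabulate (λ i → mem S (discInv π i))) π₀

data Fact (n : ℕ) : Set where
  R=      : List (Fin n) → Coloring n → Fact n      -- R̄(ν) = π
  R⪯      : List (Fin n) → Coloring n → Fact n      -- R̄(ν) ⪯ π
  T=      : List (Fin n) → Subset n → Fact n        -- T̄(ν) = W
  orbit   : Subset n → List (Fin n) → Fact n        -- Ω ⊲ orbits(ν)
  φ=      : List (Fin n) → List (Fin n) → Fact n    -- φ̄(ν') = φ̄(ν'')
  pruned  : List (Fin n) → Fact n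
  onPath  : List (Fin n) → Fact n
  canon   : Graph n → Coloring n → Fact n           -- C(G,π₀) = (G',π')

module Canon {n : ℕ} {H : Set} (_<H_ : H → H → Set)
             (hash : Graph n → Coloring n → H)
             (_<G_ : Graph n → Graph n → Set)
             (G : Graph n) (π₀ : Coloring n) where

  Rstep : Coloring n → Fin n → Coloring n
  Rstep π v = make-equitable G (ind π v) [ ⁅ v ⁆ ]

  R̄ : List (Fin n) → Coloring n
  R̄ ν = foldl Rstep (make-equitable G π₀ π₀) ν

  firstNonSingleton : Coloring n → Subset n
  firstNonSingleton []       = emptySet
  firstNonSingleton (S ∷ π) = if ∣ S ∣ ≡ᵇ 1 then firstNonSingleton π else S

  T̄ : List (Fin n) → Subset n
  T̄ ν = firstNonSingleton (R̄ ν)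

  inTreeFrom : List (Fin n) → List (Fin n) → Set
  inTreeFrom acc []       = Data.Unit.⊤
    where import Data.Unit
  inTreeFrom acc (w ∷ ws) = T (mem (T̄ acc) w) × inTreeFrom (acc ∷ʳ w) ws

  InTree : List (Fin n) → Set
  InTree ν = inTreeFrom [] ν

  Leaf : List (Fin n) → Set
  Leaf ν = InTree ν × Discrete (R̄ ν)

  φFrom : List (Fin n) → List (Fin n) → List H
  φFrom acc []       = []
  φFrom acc (w ∷ ws) = hash G (R̄ (acc ∷ʳ w)) ∷ φFrom (acc ∷ʳ w) ws

  φ̄ : List (Fin n) → List H
  φ̄ ν = φFrom [] ν

  -- lexicographic orders, a proper prefix being smaller
  _<inv_ : List H → List H → Set
  _<inv_ = Lex-< _≡_ _<H_

  _<lex_ : List (Fin n) → List (Fin n) → Set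
  _<lex_ = Lex-< _≡_ Data.Fin._<_
    where import Data.Fin

  Gν : List (Fin n) → Graph n
  Gν ν = graphBy (R̄ ν) G

  MaximalLeaf : List (Fin n) → Set
  MaximalLeaf ν = Leaf ν × (∀ μ → Leaf μ → ¬ (φ̄ ν <inv φ̄ μ))

  CanonicalLeaf : List (Fin n) → Set
  CanonicalLeaf ν =
    MaximalLeaf ν
    × (∀ μ → MaximalLeaf μ → ¬ (Gν ν <G Gν μ))
    × (∀ μ → MaximalLeaf μ → Gν μ ≡ Gν ν → ¬ (μ <lex ν))

  IsCanonicalForm : Graph n → Coloring n → Set
  IsCanonicalForm G' π' =
    ∃[ ν ] (CanonicalLeaf ν × G' ≡ graphBy (R̄ ν) G × π' ≡ colBy (R̄ ν) π₀)

  data Derivable : Fact n → Set where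
    coloringAxiom : Derivable (R⪯ [] π₀)
    individualize : ∀ {ν π} v → InTree (ν ∷ʳ v) →
      Derivable (R= ν π) → Derivable (R⪯ (ν ∷ʳ v) (ind π v))
    splitColoring : ∀ {ν π} i → i < length π → split G π i ≺ π →
      (∀ j → j < i → ¬ (split G π j ≺ π)) →
      Derivable (R⪯ ν π) → Derivable (R⪯ ν (split G π i))
    equitable : ∀ {ν π} → (∀ i → i < length π → split G π i ≡ π) →
      Derivable (R⪯ ν π) → Derivable (R= ν π)
    targetCell : ∀ {ν π} i → i < length π → 1 < ∣ cellAt π i ∣ →
      (∀ j → j < i → ∣ cellAt π j ∣ ≤ 1) →
      Derivable (R= ν π) → Derivable (T= ν (cellAt π i))
    invariantAxiom : ∀ ν → Derivable (φ= ν ν)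
    invariantsEqual : ∀ {ν' ν'' v' v'' π₁ π₂} → hash G π₁ ≡ hash G π₂ →
      Derivable (φ= ν' ν'') → Derivable (R= (ν' ∷ʳ v') π₁) →
      Derivable (R= (ν'' ∷ʳ v'') π₂) →
      Derivable (φ= (ν' ∷ʳ v') (ν'' ∷ʳ v''))
    invariantsEqualSym : ∀ {ν' ν''} → Derivable (φ= ν' ν'') → Derivable (φ= ν'' ν')
    orbitsAxiom : ∀ v ν → Derivable (orbit ⁅ v ⁆ ν)
    mergeOrbits : ∀ {Ω₁ Ω₂ ν} (σ : Permutation′ n) (w₁ w₂ : Fin n) →
      Aut G π₀ σ → actν σ ν ≡ ν → T (mem Ω₁ w₁) → T (mem Ω₂ w₂) →
      σ ⟨$⟩ʳ w₁ ≡ w₂ →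
      Derivable (orbit Ω₁ ν) → Derivable (orbit Ω₂ ν) →
      Derivable (orbit (Ω₁ ∪ Ω₂) ν)
    pruneInvariant : ∀ {ν' ν'' v' v'' π₁ π₂} → hash G π₂ <H hash G π₁ →
      Derivable (φ= ν' ν'') → Derivable (R= (ν' ∷ʳ v') π₁) →
      Derivable (R= (ν'' ∷ʳ v'') π₂) → Derivable (pruned (ν'' ∷ʳ v''))
    pruneLeaf : ∀ {ν' ν'' π₁ π₂} → Discrete π₂ →
      (¬ Discrete π₁ ⊎ graphBy π₂ G <G graphBy π₁ G) →
      Derivable (R= ν' π₁) → Derivable (R= ν'' π₂) → Derivable (φ= ν' ν'') →
      Derivable (pruned ν'')
    pruneAutomorphism : ∀ ν' ν'' (σ : Permutation′ n) → ν' <lex ν'' →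
      Aut G π₀ σ → actν σ ν' ≡ ν'' → Derivable (pruned ν'')
    pruneOrbits : ∀ {Ω ν} (w₁ w₂ : Fin n) → T (mem Ω w₂) → T (mem Ω w₁) →
      w₁ Data.Fin.< w₂ →
      Derivable (orbit Ω ν) → Derivable (pruned (ν ∷ʳ w₂))
    pruneParent : ∀ {ν W} → Derivable (T= ν W) →
      (∀ w → T (mem W w) → Derivable (pruned (ν ∷ʳ w))) → Derivable (pruned ν)
    pathAxiom : Derivable (onPath [])
    extendPath : ∀ {ν W} w → Derivable (onPath ν) → Derivable (T= ν W) →
      (∀ w' → T (mem W w') → w' ≢ w → Derivable (pruned (ν ∷ʳ w'))) →
      Derivable (onPath (ν ∷ʳ w))
    canonicalLeaf : ∀ {ν π} → Discrete π → Derivable (onPath ν) →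
      Derivable (R= ν π) → Derivable (canon (graphBy π G) (colBy π π₀))

{-# OPTIONS --safe #-}
-- Each kind of fact gets a semantic reading, and every rule is shown to preserve it.
-- R̄(ν) ⪯ π is read as: π reaches R̄(ν) by SplitColoring steps, each splitting by the first cell
-- that changes the coloring.  Such chains are deterministic, so their equitable end point is unique;
-- this gives the rule Equitable, and, as make_equitable follows the chain, it also makes R̄ commute
-- with automorphisms.  That make_equitable follows the chain is a Hopcroft-style loop invariant:
-- every cell outside α ends a block of consecutive cells with respect to whose union the coloring is
-- equitable, so the coloring is already equitable with respect to each cell before the first cell of α.
-- On the search tree, pruned(ν) means that every leaf below ν is beaten by some leaf (one with a
-- larger invariant, or the same invariant and a larger graph, or both equal and a smaller sequence),
-- on_path(ν) that every leaf not below ν is beaten, and Ω ⊲ orbits(ν) that for a, b ∈ Ω every leaf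
-- below [ν,a] has a leaf below [ν,b] with the same invariant and graph.  A leaf on the path is then
-- unbeaten, since otherwise the leaves beating it would form an infinite increasing chain in a tree
-- of depth at most n; hence it is the canonical leaf.
module Submission where

open import Defs

open import Data.Nat.Properties using (+-0-commutativeMonoid)
open import Algebra.Properties.CommutativeMonoid.Sum +-0-commutativeMonoid using (sum; sum-cong-≗; ∑-distrib-+; sum-permute)
open import Data.Bool as Bool using (Bool; true; false; _∧_; _∨_; if_then_else_; T)
open import Data.Bool.Properties using (¬-not; T-≡; T-∧; T-∨; ∨-zeroʳ)
open import Data.Fin as Fin using (Fin; toℕ) renaming (zero to fzero; suc to fsuc)
open import Data.Fin.Permutation as Permutation using (Permutation′; _⟨$⟩ʳ_; _⟨$⟩ˡ_; inverseˡ; inverseʳ)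
import Data.Fin.Properties as Finₚ
open import Data.Fin.Subset using (Subset; ∣_∣; ⁅_⁆; _∩_; _∪_; _-_)
open import Data.Fin.Subset.Properties using (∣p∣≤n; ∣⁅x⁆∣≡1; x∈⁅x⁆; x∈⁅y⁆⇒x≡y; p─⊥≡p)
open import Data.List as List using (List; []; _∷_; _++_; _∷ʳ_; [_]; map; concatMap; foldl; length; upTo; applyUpTo)
open import Data.List.Membership.Propositional using (_∈_; find; lose)
open import Data.List.Membership.Propositional.Properties
  using (∈-lookup; ∈-map⁺; ∈-map⁻; ∈-concatMap⁺; ∈-concatMap⁻; ∈-++⁺ˡ; ∈-++⁺ʳ; ∈-++⁻; ∈-insert; ∈-allFin)
open import Data.List.Properties as Listₚ
  using (∷-injective; ∷-injectiveˡ; ∷-injectiveʳ; ∷ʳ-injective; ++-assoc; ++-identityʳ; length-++; length-map; map-++; concatMap-++)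
open import Data.List.Relation.Binary.Lex.Core using (Lex-<; base; halt; this; next)
import Data.List.Relation.Binary.Lex.Strict as Lex
open import Data.List.Relation.Binary.Permutation.Propositional as ↭ using (_↭_; ↭-sym)
open import Data.List.Relation.Binary.Permutation.Propositional.Properties using (∷↭∷ʳ; ∈-resp-↭)
import Data.List.Relation.Binary.Pointwise as Pointwise
open import Data.List.Relation.Unary.All as All using (All; []; _∷_)
import Data.List.Relation.Unary.All.Properties as All
open import Data.List.Relation.Unary.Any as Any using (Any; here; there)
import Data.List.Relation.Unary.Any.Properties as Any
open import Data.Maybe as Maybe using (just; nothing; fromMaybe)
open import Data.Nat using (ℕ; zero; suc; _+_; _*_; _∸_; _⊔_; _≤_; _<_; z≤n; s≤s; _≡ᵇ_)
open import Data.Nat.Properties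
  using ( +-comm; +-assoc; +-suc; +-identityʳ; +-cancelʳ-≡; *-distribʳ-+; *-distribˡ-+; suc-injective; ≡ᵇ⇒≡; ≡⇒≡ᵇ
        ; ≤-refl; ≤-reflexive; ≤-trans; ≤-pred; <-cmp; <⇒≱; <⇒≢; n<1+n; m≤n⇒m≤1+n; m≤n⇒m<n∨m≡n
        ; m≤n+m; m≤m+n; m∸n≤m; m+[n∸m]≡n; m+n∸m≡n; ⊔-identityʳ; ⊔-sel
        ; +-mono-≤; +-monoˡ-≤; +-monoʳ-≤; +-monoˡ-<; +-monoʳ-<; *-monoˡ-≤; *-monoʳ-≤; module ≤-Reasoning )
open import Data.Product as Product using (Σ; _×_; ∃; ∃₂; _,_; proj₁; proj₂)
open import Data.Sum using (_⊎_; inj₁; inj₂)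
open import Data.Vec using (Vec; []; _∷_; lookup; tabulate)
open import Data.Vec.Properties as Vecₚ using (lookup-zipWith; lookup∘tabulate; tabulate∘lookup; tabulate-cong; []=⇒lookup; lookup⇒[]=)
open import Function using (_∘_; id)
open import Function.Bundles using (Equivalence)
open import Relation.Binary.Construct.Closure.ReflexiveTransitive using (Star; ε; _◅_)
open import Relation.Binary.Definitions using (DecidableEquality; Transitive; tri<; tri≈; tri>)
open import Relation.Binary.PropositionalEquality hiding ([_])
open import Relation.Binary.Structures using (IsStrictTotalOrder)
open import Relation.Nullary using (¬_; Dec; yes; no; contradiction)

bit : Bool → ℕ
bit b = if b then 1 else 0

T⇒≡true : ∀ {b} → T b → b ≡ true
T⇒≡true = Equivalence.to T-≡

≡true⇒T : ∀ {b} → b ≡ true → T b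
≡true⇒T = Equivalence.from T-≡

≡ᵇ-refl : ∀ x → (x ≡ᵇ x) ≡ true
≡ᵇ-refl x = T⇒≡true (≡⇒≡ᵇ x x refl)

≡ᵇ≡true⇒≡ : ∀ x y → (x ≡ᵇ y) ≡ true → x ≡ y
≡ᵇ≡true⇒≡ x y h = ≡ᵇ⇒≡ x y (≡true⇒T h)

≢⇒≡ᵇ≡false : ∀ {x y} → x ≢ y → (x ≡ᵇ y) ≡ false
≢⇒≡ᵇ≡false {x} {y} x≢y = ¬-not (x≢y ∘ ≡ᵇ≡true⇒≡ x y)

lookup-ext : ∀ {A : Set} {n} {xs ys : Vec A n} → (∀ i → lookup xs i ≡ lookup ys i) → xs ≡ ys
lookup-ext {xs = xs} {ys} h = trans (sym (tabulate∘lookup xs)) (trans (tabulate-cong h) (tabulate∘lookup ys))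

private variable n : ℕ

-- Subsets and cell counts

mem-tabulate : ∀ (f : Fin n → Bool) v → mem (tabulate f) v ≡ f v
mem-tabulate = lookup∘tabulate

mem-∩ : ∀ (A B : Subset n) v → mem (A ∩ B) v ≡ mem A v ∧ mem B v
mem-∩ A B v = lookup-zipWith _∧_ v A B

mem-∪ : ∀ (A B : Subset n) v → mem (A ∪ B) v ≡ mem A v ∨ mem B v
mem-∪ A B v = lookup-zipWith _∨_ v A B

mem-emptySet : ∀ v → mem (emptySet {n}) v ≡ false
mem-emptySet = lookup∘tabulate _

mem-⁅⁆-self : ∀ (v : Fin n) → mem ⁅ v ⁆ v ≡ true
mem-⁅⁆-self v = []=⇒lookup (x∈⁅x⁆ v)

mem-⁅⁆⇒≡ : ∀ (v u : Fin n) → mem ⁅ v ⁆ u ≡ true → u ≡ v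
mem-⁅⁆⇒≡ v u h = x∈⁅y⁆⇒x≡y v (lookup⇒[]= u ⁅ v ⁆ h)

mem-⁅⁆-other : ∀ (v u : Fin n) → u ≢ v → mem ⁅ v ⁆ u ≡ false
mem-⁅⁆-other v u u≢v = ¬-not (λ h → u≢v (mem-⁅⁆⇒≡ v u h))

mem-minus-self : ∀ (S : Subset n) v → mem (S - v) v ≡ false
mem-minus-self (x ∷ S) fzero    = refl
mem-minus-self (x ∷ S) (fsuc v) = mem-minus-self S v

mem-minus-other : ∀ (S : Subset n) v u → u ≢ v → mem (S - v) u ≡ mem S u
mem-minus-other (x ∷ S) fzero    fzero    u≢v = contradiction refl u≢v
mem-minus-other (x ∷ S) fzero    (fsuc u) _   = cong (λ T → lookup T u) (p─⊥≡p S)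
mem-minus-other (x ∷ S) (fsuc v) fzero    _   = refl
mem-minus-other (x ∷ S) (fsuc v) (fsuc u) u≢v = mem-minus-other S v u (u≢v ∘ cong fsuc)

mem-minus⇒mem : ∀ (S : Subset n) v u → mem (S - v) u ≡ true → mem S u ≡ true × u ≢ v
mem-minus⇒mem S v u h with u Fin.≟ v
... | yes refl = contradiction (trans (sym (mem-minus-self S v)) h) λ ()
... | no u≢v   = trans (sym (mem-minus-other S v u u≢v)) h , u≢v

nonempty-witness : ∀ (S : Subset n) → 1 ≤ ∣ S ∣ → ∃ λ v → mem S v ≡ true
nonempty-witness (true  ∷ S) _ = fzero , refl
nonempty-witness (false ∷ S) h with nonempty-witness S h
... | v , mv = fsuc v , mv

∣S∣≡0⇒mem≡false : ∀ (S : Subset n) v → ∣ S ∣ ≡ 0 → mem S v ≡ false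
∣S∣≡0⇒mem≡false (false ∷ S) fzero    _ = refl
∣S∣≡0⇒mem≡false (false ∷ S) (fsuc v) h = ∣S∣≡0⇒mem≡false S v h

∣S∣≡1⇒mem-unique : ∀ (S : Subset n) u w → ∣ S ∣ ≡ 1 → mem S u ≡ true → mem S w ≡ true → u ≡ w
∣S∣≡1⇒mem-unique (true  ∷ S) fzero    fzero    _ _  _  = refl
∣S∣≡1⇒mem-unique (true  ∷ S) fzero    (fsuc w) c _  mw =
  contradiction (trans (sym (∣S∣≡0⇒mem≡false S w (suc-injective c))) mw) λ ()
∣S∣≡1⇒mem-unique (true  ∷ S) (fsuc u) _        c mu _  =
  contradiction (trans (sym (∣S∣≡0⇒mem≡false S u (suc-injective c))) mu) λ ()
∣S∣≡1⇒mem-unique (false ∷ S) (fsuc u) (fsuc w) c mu mw = cong fsuc (∣S∣≡1⇒mem-unique S u w c mu mw)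

∣S∣≡1⇒S≡⁅v⁆ : ∀ (S : Subset n) v → mem S v ≡ true → ∣ S ∣ ≡ 1 → S ≡ ⁅ v ⁆
∣S∣≡1⇒S≡⁅v⁆ S v mv c = lookup-ext pointwise
  where
  pointwise : ∀ u → mem S u ≡ mem ⁅ v ⁆ u
  pointwise u with u Fin.≟ v
  ... | yes refl = trans mv (sym (mem-⁅⁆-self u))
  ... | no u≢v with mem S u in mu
  ...   | true  = contradiction (∣S∣≡1⇒mem-unique S u v c mu mv) u≢v
  ...   | false = sym (mem-⁅⁆-other v u u≢v)

suc∣S-v∣≡∣S∣ : ∀ (S : Subset n) v → mem S v ≡ true → suc ∣ S - v ∣ ≡ ∣ S ∣
suc∣S-v∣≡∣S∣ (true  ∷ S) fzero    _  = cong (suc ∘ ∣_∣) (p─⊥≡p S)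
suc∣S-v∣≡∣S∣ (true  ∷ S) (fsuc v) mv = cong suc (suc∣S-v∣≡∣S∣ S v mv)
suc∣S-v∣≡∣S∣ (false ∷ S) (fsuc v) mv = suc∣S-v∣≡∣S∣ S v mv

cellsContaining-++ : ∀ (A B : Coloring n) v → cellsContaining (A ++ B) v ≡ cellsContaining A v + cellsContaining B v
cellsContaining-++ []      B v = refl
cellsContaining-++ (S ∷ A) B v =
  trans (cong (bit (mem S v) +_) (cellsContaining-++ A B v)) (sym (+-assoc (bit (mem S v)) _ _))

cellsContaining-concatMap : ∀ (f : Subset n → Coloring n) p v →
  (∀ X → cellsContaining (f X) v ≡ bit (mem X v)) → cellsContaining (concatMap f p) v ≡ cellsContaining p v
cellsContaining-concatMap f []      v h = refl
cellsContaining-concatMap f (X ∷ p) v h =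
  trans (cellsContaining-++ (f X) (concatMap f p) v) (cong₂ _+_ (h X) (cellsContaining-concatMap f p v h))

cellsContaining-↭ : ∀ {A B : Coloring n} → A ↭ B → ∀ v → cellsContaining A v ≡ cellsContaining B v
cellsContaining-↭ ↭.refl          v = refl
cellsContaining-↭ (↭.prep S p)    v = cong (bit (mem S v) +_) (cellsContaining-↭ p v)
cellsContaining-↭ (↭.swap S T p)  v =
  trans (sym (+-assoc (bit (mem S v)) _ _))
    (trans (cong₂ _+_ (+-comm (bit (mem S v)) _) (cellsContaining-↭ p v)) (+-assoc (bit (mem T v)) _ _))
cellsContaining-↭ (↭.trans p q)   v = trans (cellsContaining-↭ p v) (cellsContaining-↭ q v)

∈⇒1≤cellsContaining : ∀ (L : Coloring n) {Y} v → Y ∈ L → mem Y v ≡ true → 1 ≤ cellsContaining L v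
∈⇒1≤cellsContaining (S ∷ L) v (here refl) mv rewrite mv = s≤s z≤n
∈⇒1≤cellsContaining (S ∷ L) v (there Y∈L) mv =
  ≤-trans (∈⇒1≤cellsContaining L v Y∈L mv) (m≤n+m _ (bit (mem S v)))

1≤cellsContaining⇒∈ : ∀ (L : Coloring n) v → 1 ≤ cellsContaining L v → ∃ λ Y → Y ∈ L × mem Y v ≡ true
1≤cellsContaining⇒∈ (S ∷ L) v h with mem S v in mv
... | true  = S , here refl , mv
... | false with 1≤cellsContaining⇒∈ L v h
...   | Y , Y∈L , mY = Y , there Y∈L , mY

cellOf : ∀ {π : Coloring n} → IsColoring π → ∀ v → ∃ λ Y → Y ∈ π × mem Y v ≡ true
cellOf {π = π} (_ , once) v = 1≤cellsContaining⇒∈ π v (≤-reflexive (sym (once v)))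

suc≡1⇒≱1 : ∀ {m} → suc m ≡ 1 → ¬ 1 ≤ m
suc≡1⇒≱1 refl ()

lookup-unique : ∀ (π : Coloring n) v (i j : Fin (length π)) → cellsContaining π v ≡ 1 →
  mem (List.lookup π i) v ≡ true → mem (List.lookup π j) v ≡ true → i ≡ j
lookup-unique (S ∷ π) v fzero    fzero    _ _  _  = refl
lookup-unique (S ∷ π) v fzero    (fsuc j) c mi mj =
  contradiction (∈⇒1≤cellsContaining π v (∈-lookup j) mj) (suc≡1⇒≱1 (subst (λ b → bit b + _ ≡ 1) mi c))
lookup-unique (S ∷ π) v (fsuc i) fzero    c mi mj =
  contradiction (∈⇒1≤cellsContaining π v (∈-lookup i) mi) (suc≡1⇒≱1 (subst (λ b → bit b + _ ≡ 1) mj c))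
lookup-unique (S ∷ π) v (fsuc i) (fsuc j) c mi mj with mem S v in mv
... | true  = contradiction (∈⇒1≤cellsContaining π v (∈-lookup i) mi) (suc≡1⇒≱1 c)
... | false = cong fsuc (lookup-unique π v i j c mi mj)

length≤n : ∀ (π : Coloring n) → IsColoring π → length π ≤ n
length≤n π (nonempty , once) = Finₚ.injective⇒≤ {f = representative} injective
  where
  representative : Fin (length π) → Fin _
  representative i = proj₁ (nonempty-witness (List.lookup π i) (All.lookup nonempty (∈-lookup i)))
  injective : ∀ {i j} → representative i ≡ representative j → i ≡ j
  injective {i} {j} e = lookup-unique π (representative i) i j (once _)
    (proj₂ (nonempty-witness (List.lookup π i) (All.lookup nonempty (∈-lookup i))))
    (subst (λ v → mem (List.lookup π j) v ≡ true) (sym e)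
      (proj₂ (nonempty-witness (List.lookup π j) (All.lookup nonempty (∈-lookup j)))))

bit-∧ : ∀ a b → bit (a ∧ b) ≡ bit a * bit b
bit-∧ true  b = sym (+-identityʳ (bit b))
bit-∧ false b = refl

∣S∣≡sum : ∀ (S : Subset n) → ∣ S ∣ ≡ sum (λ v → bit (mem S v))
∣S∣≡sum []          = refl
∣S∣≡sum (true  ∷ S) = cong suc (∣S∣≡sum S)
∣S∣≡sum (false ∷ S) = ∣S∣≡sum S

-- Splitting a cell by degrees

occurrences : (ℕ → ℕ) → ℕ → ℕ → ℕ
occurrences f zero    x = 0
occurrences f (suc m) x = bit (x ≡ᵇ f 0) + occurrences (f ∘ suc) m x

occurrences-none : ∀ f m x → (∀ i → f i ≢ x) → occurrences f m x ≡ 0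
occurrences-none f zero    x h = refl
occurrences-none f (suc m) x h rewrite ≢⇒≡ᵇ≡false (λ e → h 0 (sym e)) =
  occurrences-none (f ∘ suc) m x (h ∘ suc)

occurrences-once : ∀ f m x j → j < m → f j ≡ x → (∀ i → i ≢ j → f i ≢ x) → occurrences f m x ≡ 1
occurrences-once f (suc m) x zero    _         refl h rewrite ≡ᵇ-refl (f 0) =
  cong suc (occurrences-none (f ∘ suc) m (f 0) (λ i → h (suc i) (λ ())))
occurrences-once f (suc m) x (suc j) (s≤s j<m) e    h rewrite ≢⇒≡ᵇ≡false (λ e′ → h 0 (λ ()) (sym e′)) =
  occurrences-once (f ∘ suc) m x j j<m e (λ i i≢j → h (suc i) (i≢j ∘ suc-injective))

cellsContaining-keepNonempty : ∀ (L : List (Subset n)) v → cellsContaining (keepNonempty L) v ≡ cellsContaining L v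
cellsContaining-keepNonempty []      v = refl
cellsContaining-keepNonempty (S ∷ L) v with ∣ S ∣ in e
... | zero  rewrite ∣S∣≡0⇒mem≡false S v e = cellsContaining-keepNonempty L v
... | suc _ = cong (bit (mem S v) +_) (cellsContaining-keepNonempty L v)

∈-keepNonempty⁻ : ∀ (L : List (Subset n)) {Y} → Y ∈ keepNonempty L → Y ∈ L × 1 ≤ ∣ Y ∣
∈-keepNonempty⁻ (S ∷ L) Y∈ with ∣ S ∣ in e
... | zero = let (Y∈L , ne) = ∈-keepNonempty⁻ L Y∈ in there Y∈L , ne
∈-keepNonempty⁻ (S ∷ L) (here refl) | suc _ rewrite e = here refl , s≤s z≤n
∈-keepNonempty⁻ (S ∷ L) (there Y∈)  | suc _ = let (Y∈L , ne) = ∈-keepNonempty⁻ L Y∈ in there Y∈L , ne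

maxSize-attained : ∀ (Y : Subset n) L → Any (λ Z → ∣ Z ∣ ≡ maxSize (Y ∷ L)) (Y ∷ L)
maxSize-attained Y []      = here (sym (⊔-identityʳ ∣ Y ∣))
maxSize-attained Y (Z ∷ L) with ⊔-sel ∣ Y ∣ (maxSize (Z ∷ L))
... | inj₁ e = here (sym e)
... | inj₂ e rewrite e = there (maxSize-attained Z L)

pickFirst-selects : ∀ m (L : List (Subset n)) → Any (λ Y → ∣ Y ∣ ≡ m) L →
  ∃₂ λ rest r → pickFirst m L ≡ (rest , just r) × r ∷ rest ↭ L
pickFirst-selects m (S ∷ L) a with ∣ S ∣ ≡ᵇ m in e
... | true = L , S , refl , ↭.refl
pickFirst-selects m (S ∷ L) (here refl) | false = contradiction (trans (sym (≡ᵇ-refl ∣ S ∣)) e) λ ()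
pickFirst-selects m (S ∷ L) (there a)   | false with pickFirst-selects m L a
... | rest , r , eq , p rewrite eq = S ∷ rest , r , refl , ↭.trans (↭.swap r S ↭.refl) (↭.prep S p)

all≡⇒singleton : ∀ {L : List (Subset n)} {X} v → (∀ {Y} → Y ∈ L → Y ≡ X) → mem X v ≡ true →
  cellsContaining L v ≡ 1 → L ≡ [ X ]
all≡⇒singleton {L = []}    v all≡ mv ()
all≡⇒singleton {L = Y ∷ L} v all≡ mv c with all≡ (here refl)
... | refl rewrite mv = cong (Y ∷_) (empty L (suc-injective c) (all≡ ∘ there))
  where
  empty : ∀ L → cellsContaining L v ≡ 0 → (∀ {Z} → Z ∈ L → Z ≡ Y) → L ≡ []
  empty []      _ _    = refl
  empty (Z ∷ L) c all≡ with all≡ (here refl)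
  ... | refl rewrite mv = contradiction c λ ()

UniformOn : (Fin n → ℕ) → Subset n → Set
UniformOn f X = ∀ u w → mem X u ≡ true → mem X w ≡ true → f u ≡ f w

Uniform : (Fin n → ℕ) → Coloring n → Set
Uniform f π = ∀ {X} → X ∈ π → UniformOn f X

Refines : Coloring n → Coloring n → Set
Refines π′ π = ∀ {Y} → Y ∈ π′ → ∃ λ X → X ∈ π × (∀ u → mem Y u ≡ true → mem X u ≡ true)

Uniform-refines : ∀ {f} {π′ π : Coloring n} → Refines π′ π → Uniform f π → Uniform f π′
Uniform-refines refines uniform Y∈ u w mu mw with refines Y∈
... | X , X∈ , Y⊆X = uniform X∈ u w (Y⊆X u mu) (Y⊆X w mw)

col-++-inside : ∀ (A B : Coloring n) u → 1 ≤ cellsContaining A u → col (A ++ B) u ≡ col A u × col A u < length A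
col-++-inside (S ∷ A) B u h with mem S u
... | true  = refl , s≤s z≤n
... | false with col-++-inside A B u h
...   | e , lt = cong suc e , s≤s lt

col-++-outside : ∀ (A B : Coloring n) u → cellsContaining A u ≡ 0 → col (A ++ B) u ≡ length A + col B u
col-++-outside []      B u h = refl
col-++-outside (S ∷ A) B u h with mem S u
... | false = cong suc (col-++-outside A B u h)

concatMap-⪯ : ∀ (f : Subset n → Coloring n) → (∀ X v → cellsContaining (f X) v ≡ bit (mem X v)) →
  ∀ π → concatMap f π ⪯ π
concatMap-⪯ f covers (X ∷ π) u v lt with mem X u in mu | mem X v in mv
... | true  | true  = contradiction lt λ ()
... | false | true  = contradiction lt λ ()
... | false | false
  rewrite col-++-outside (f X) (concatMap f π) u (trans (covers X u) (cong bit mu))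
        | col-++-outside (f X) (concatMap f π) v (trans (covers X v) (cong bit mv)) =
    +-monoʳ-< (length (f X)) (concatMap-⪯ f covers π u v (≤-pred lt))
... | true  | false
  with col-++-inside (f X) (concatMap f π) u (≤-reflexive (sym (trans (covers X u) (cong bit mu))))
... | colu≡ , colu< rewrite colu≡ | col-++-outside (f X) (concatMap f π) v (trans (covers X v) (cong bit mv)) =
    ≤-trans colu< (m≤m+n _ _)

_≟ˢ_ : DecidableEquality (Subset n)
_≟ˢ_ = Vecₚ.≡-dec Bool._≟_

_≟ᶜ_ : DecidableEquality (Coloring n)
_≟ᶜ_ = Listₚ.≡-dec _≟ˢ_

eqSubset-refl : ∀ (S : Subset n) → eqSubset S S ≡ true
eqSubset-refl []          = refl
eqSubset-refl (true  ∷ S) = eqSubset-refl S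
eqSubset-refl (false ∷ S) = eqSubset-refl S

eqSubset⇒≡ : ∀ (S T : Subset n) → eqSubset S T ≡ true → S ≡ T
eqSubset⇒≡ []          []          _ = refl
eqSubset⇒≡ (true  ∷ S) (true  ∷ T) h = cong (true ∷_) (eqSubset⇒≡ S T h)
eqSubset⇒≡ (false ∷ S) (false ∷ T) h = cong (false ∷_) (eqSubset⇒≡ S T h)

∈⇒elemᵇ : ∀ {Y : Subset n} {L} → Y ∈ L → elemᵇ Y L ≡ true
∈⇒elemᵇ {Y = Y} (here refl) rewrite eqSubset-refl Y = refl
∈⇒elemᵇ {Y = Y} {X ∷ L} (there Y∈L) rewrite ∈⇒elemᵇ Y∈L = ∨-zeroʳ (eqSubset Y X)

elemᵇ⇒∈ : ∀ (Y : Subset n) L → elemᵇ Y L ≡ true → Y ∈ L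
elemᵇ⇒∈ Y (X ∷ L) h with eqSubset Y X in e
... | true  = here (eqSubset⇒≡ Y X e)
... | false = there (elemᵇ⇒∈ Y L h)

∈-removeAll⁻ : ∀ (W : Subset n) {Y} L → Y ∈ removeAll W L → Y ∈ L
∈-removeAll⁻ W (X ∷ L) Y∈ with eqSubset W X
... | true = there (∈-removeAll⁻ W L Y∈)
∈-removeAll⁻ W (X ∷ L) (here e)  | false = here e
∈-removeAll⁻ W (X ∷ L) (there Y∈) | false = there (∈-removeAll⁻ W L Y∈)

∈-removeAll⁺ : ∀ (W : Subset n) {Y} L → Y ∈ L → Y ≢ W → Y ∈ removeAll W L
∈-removeAll⁺ W (X ∷ L) (here refl) Y≢W with eqSubset W X in e
... | true  = contradiction (sym (eqSubset⇒≡ W X e)) Y≢W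
... | false = here refl
∈-removeAll⁺ W (X ∷ L) (there Y∈) Y≢W with eqSubset W X
... | true  = ∈-removeAll⁺ W L Y∈ Y≢W
... | false = there (∈-removeAll⁺ W L Y∈ Y≢W)

∉-removeAll⁻ : ∀ (W C : Subset n) L → elemᵇ C (removeAll W L) ≡ false → elemᵇ C L ≡ false ⊎ C ≡ W
∉-removeAll⁻ W C L h with elemᵇ C L in e
... | false = inj₁ refl
... | true with C ≟ˢ W
...   | yes C≡W = inj₂ C≡W
...   | no C≢W  = contradiction (trans (sym (∈⇒elemᵇ (∈-removeAll⁺ W L (elemᵇ⇒∈ C L e) C≢W))) h) λ ()

length-removeAll : ∀ (W : Subset n) L → length (removeAll W L) ≤ length L
length-removeAll W []      = z≤n
length-removeAll W (X ∷ L) with eqSubset W X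
... | true  = m≤n⇒m≤1+n (length-removeAll W L)
... | false = s≤s (length-removeAll W L)

length-removeAll-< : ∀ (W : Subset n) L → W ∈ L → length (removeAll W L) < length L
length-removeAll-< W (X ∷ L) (here refl) rewrite eqSubset-refl W = s≤s (length-removeAll W L)
length-removeAll-< W (X ∷ L) (there W∈) with eqSubset W X
... | true  = m≤n⇒m≤1+n (length-removeAll-< W L W∈)
... | false = s≤s (length-removeAll-< W L W∈)

module _ {A : Set} where

  position-in-[x] : ∀ {x c : A} a b → [ x ] ≡ a ++ c ∷ b → a ≡ [] × c ≡ x
  position-in-[x] []          b refl = refl , refl
  position-in-[x] (_ ∷ [])    b ()
  position-in-[x] (_ ∷ _ ∷ _) b ()

  position-in-[x,y] : ∀ {x y c : A} a b → x ∷ [ y ] ≡ a ++ c ∷ b → (a ≡ [] × c ≡ x) ⊎ (a ≡ [ x ] × c ≡ y)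
  position-in-[x,y] []              b refl = inj₁ (refl , refl)
  position-in-[x,y] (_ ∷ [])        b refl = inj₂ (refl , refl)
  position-in-[x,y] (_ ∷ _ ∷ [])    b ()
  position-in-[x,y] (_ ∷ _ ∷ _ ∷ _) b ()

  ++≡++∷-split : ∀ (xs ys pre : List A) C post → xs ++ ys ≡ pre ++ C ∷ post →
    (∃ λ b → xs ≡ pre ++ C ∷ b) ⊎ (∃ λ pre₂ → ys ≡ pre₂ ++ C ∷ post × pre ≡ xs ++ pre₂)
  ++≡++∷-split []       ys pre       C post e = inj₂ (pre , e , refl)
  ++≡++∷-split (x ∷ xs) ys []        C post e with ∷-injective e
  ... | refl , _ = inj₁ (xs , refl)
  ++≡++∷-split (x ∷ xs) ys (_ ∷ pre) C post e with ∷-injective e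
  ... | refl , e′ with ++≡++∷-split xs ys pre C post e′
  ...   | inj₁ (b , xs≡)             = inj₁ (b , cong (x ∷_) xs≡)
  ...   | inj₂ (pre₂ , ys≡ , pre≡)   = inj₂ (pre₂ , ys≡ , cong (x ∷_) pre≡)

  ∷ʳ≡++∷∷⇒∈ : ∀ (xs : List A) y a c d ds → xs ++ [ y ] ≡ a ++ c ∷ d ∷ ds → c ∈ xs
  ∷ʳ≡++∷∷⇒∈ []       y []            c d ds ()
  ∷ʳ≡++∷∷⇒∈ []       y (_ ∷ [])      c d ds ()
  ∷ʳ≡++∷∷⇒∈ []       y (_ ∷ _ ∷ _)   c d ds ()
  ∷ʳ≡++∷∷⇒∈ (x ∷ xs) y []            c d ds e with ∷-injective e
  ... | refl , _ = here refl
  ∷ʳ≡++∷∷⇒∈ (x ∷ xs) y (_ ∷ a)       c d ds e = there (∷ʳ≡++∷∷⇒∈ xs y a c d ds (∷-injectiveʳ e))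

record Located {A B : Set} (f : A → List B) (xs : List A) (pre : List B) (C : B) : Set where
  field
    before  : List A
    source  : A
    after   : List A
    inner-before inner-after : List B
    xs≡      : xs ≡ before ++ source ∷ after
    image≡   : f source ≡ inner-before ++ C ∷ inner-after
    pre≡     : pre ≡ concatMap f before ++ inner-before

locate : ∀ {A B : Set} (f : A → List B) xs pre C post → concatMap f xs ≡ pre ++ C ∷ post → Located f xs pre C
locate f []       []      C post ()
locate f []       (_ ∷ _) C post ()
locate f (X ∷ xs) pre     C post e with ++≡++∷-split (f X) (concatMap f xs) pre C post e
... | inj₁ (b , fX≡)         = record { before = [] ; source = X ; after = xs ; inner-before = pre ; inner-after = b
                                      ; xs≡ = refl ; image≡ = fX≡ ; pre≡ = refl }
... | inj₂ (pre₂ , rest≡ , pre≡) = record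
  { before = X ∷ before ; source = source ; after = after ; inner-before = inner-before ; inner-after = inner-after
  ; xs≡ = cong (X ∷_) xs≡ ; image≡ = image≡
  ; pre≡ = trans pre≡ (trans (cong (f X ++_) pre≡′) (sym (++-assoc (f X) (concatMap f before) inner-before))) }
  where
  open Located (locate f xs pre₂ C post rest≡) renaming (pre≡ to pre≡′)

cellAt-∈ : ∀ (π : Coloring n) i → i < length π → cellAt π i ∈ π
cellAt-∈ (S ∷ π) zero    _         = here refl
cellAt-∈ (S ∷ π) (suc i) (s≤s i<) = there (cellAt-∈ π i i<)

∈⇒cellAt : ∀ (π : Coloring n) {X} → X ∈ π → ∃ λ i → i < length π × cellAt π i ≡ X
∈⇒cellAt (S ∷ π) (here refl) = 0 , s≤s z≤n , refl
∈⇒cellAt (S ∷ π) (there X∈) with ∈⇒cellAt π X∈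
... | i , i< , e = suc i , s≤s i< , e

cellAt-length : ∀ (pre : Coloring n) W post → cellAt (pre ++ W ∷ post) (length pre) ≡ W
cellAt-length []        W post = refl
cellAt-length (_ ∷ pre) W post = cellAt-length pre W post

cellAt-prefix : ∀ (pre post : Coloring n) j → j < length pre → cellAt (pre ++ post) j ∈ pre
cellAt-prefix (_ ∷ pre) post zero    _        = here refl
cellAt-prefix (_ ∷ pre) post (suc j) (s≤s j<) = there (cellAt-prefix pre post j j<)

discrete⇒∣X∣≡1 : ∀ (π : Coloring n) → Discrete π → ∀ {X} → X ∈ π → ∣ X ∣ ≡ 1
discrete⇒∣X∣≡1 (S ∷ π) d X∈ with Equivalence.to (T-∧ {∣ S ∣ ≡ᵇ 1}) d
discrete⇒∣X∣≡1 (S ∷ π) d (here refl) | S≡1 , _  = ≡ᵇ⇒≡ _ _ S≡1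
discrete⇒∣X∣≡1 (S ∷ π) d (there X∈)  | _ , d′   = discrete⇒∣X∣≡1 π d′ X∈

discrete⇒uniform : ∀ {f} (π : Coloring n) → Discrete π → Uniform f π
discrete⇒uniform π d {X} X∈ u w mu mw rewrite ∣S∣≡1⇒mem-unique X u w (discrete⇒∣X∣≡1 π d X∈) mu mw = refl

firstIn-just : ∀ (π : Coloring n) α {W} → firstIn π α ≡ just W →
  ∃₂ λ pre post → π ≡ pre ++ W ∷ post × All (λ X → elemᵇ X α ≡ false) pre × elemᵇ W α ≡ true
firstIn-just (X ∷ π) α e with elemᵇ X α in X∈α
firstIn-just (X ∷ π) α refl | true = [] , π , refl , [] , X∈α
... | false with firstIn-just π α e
...   | pre , post , π≡ , unlisted , W∈α = X ∷ pre , post , cong (X ∷_) π≡ , X∈α ∷ unlisted , W∈α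

firstIn-nothing : ∀ (π : Coloring n) α → firstIn π α ≡ nothing → All (λ X → elemᵇ X α ≡ false) π
firstIn-nothing []      α e = []
firstIn-nothing (X ∷ π) α e with elemᵇ X α in X∈α
... | false = X∈α ∷ firstIn-nothing π α e

-- Splitting by W ∈ α removes W from α, and each of the Δ new cells adds one entry to α
-- but removes two from 2 * (n ∸ length π).
loopMeasure : Coloring n → List (Subset n) → ℕ
loopMeasure {n} π α = length α + 2 * (n ∸ length π)

measure-decreases : ∀ n r a Δ ℓ → r < a → ℓ + Δ ≤ n → (r + Δ) + 2 * (n ∸ (ℓ + Δ)) < a + 2 * (n ∸ ℓ)
measure-decreases n r a Δ ℓ r<a ℓ+Δ≤n = begin-strict
  (r + Δ) + 2 * x      <⟨ +-monoˡ-< (2 * x) (+-monoˡ-< Δ r<a) ⟩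
  (a + Δ) + 2 * x      ≤⟨ +-monoˡ-≤ (2 * x) (+-monoʳ-≤ a (m≤m+n Δ (Δ + 0))) ⟩
  (a + 2 * Δ) + 2 * x  ≡⟨ +-assoc a (2 * Δ) (2 * x) ⟩
  a + (2 * Δ + 2 * x)  ≡⟨ cong (a +_) (*-distribˡ-+ 2 Δ x) ⟨
  a + 2 * (Δ + x)      ≡⟨ cong (λ m → a + 2 * m) n∸ℓ≡Δ+x ⟨
  a + 2 * (n ∸ ℓ)      ∎
  where
  open ≤-Reasoning
  x : ℕ
  x = n ∸ (ℓ + Δ)
  n∸ℓ≡Δ+x : n ∸ ℓ ≡ Δ + x
  n∸ℓ≡Δ+x = trans (cong (_∸ ℓ) (sym (m+[n∸m]≡n ℓ+Δ≤n))) (trans (cong (_∸ ℓ) (+-assoc ℓ Δ x)) (m+n∸m≡n ℓ (Δ + x)))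

module _ {n : ℕ} (G : Graph n) where

  fragment : Subset n → Subset n → ℕ → Subset n
  fragment W X d = tabulate (λ v → mem X v ∧ (deg G W v ≡ᵇ d))

  mem-fragment⁻ : ∀ W X d u → mem (fragment W X d) u ≡ true → mem X u ≡ true × deg G W u ≡ d
  mem-fragment⁻ W X d u h rewrite mem-tabulate (λ v → mem X v ∧ (deg G W v ≡ᵇ d)) u with mem X u
  ... | true  = refl , ≡ᵇ≡true⇒≡ _ _ h

  cellsContaining-fragments : ∀ W X v f m → cellsContaining (map (fragment W X) (applyUpTo f m)) v
                              ≡ (if mem X v then occurrences f m (deg G W v) else 0)
  cellsContaining-fragments W X v f zero with mem X v
  ... | true  = refl
  ... | false = refl
  cellsContaining-fragments W X v f (suc m)
    rewrite mem-tabulate (λ u → mem X u ∧ (deg G W u ≡ᵇ f 0)) v | cellsContaining-fragments W X v (f ∘ suc) m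
    with mem X v
  ... | true  = refl
  ... | false = refl

  cellsContaining-fragmentsAsc : ∀ W X v → cellsContaining (fragmentsAsc G W X) v ≡ bit (mem X v)
  cellsContaining-fragmentsAsc W X v =
    trans (cellsContaining-keepNonempty (map (fragment W X) (upTo (suc n))) v)
          (trans (cellsContaining-fragments W X v id (suc n)) once)
    where
    once : (if mem X v then occurrences id (suc n) (deg G W v) else 0) ≡ bit (mem X v)
    once with mem X v
    ... | true  = occurrences-once id (suc n) _ _ (s≤s (∣p∣≤n (W ∩ lookup G v))) refl (λ i i≢d e → i≢d e)
    ... | false = refl

  ∈-fragmentsAsc⁻ : ∀ W X {Y} → Y ∈ fragmentsAsc G W X → 1 ≤ ∣ Y ∣ × ∃ λ d → Y ≡ fragment W X d
  ∈-fragmentsAsc⁻ W X Y∈ with ∈-keepNonempty⁻ (map (fragment W X) (upTo (suc n))) Y∈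
  ... | Y∈map , ne with ∈-map⁻ (fragment W X) Y∈map
  ...   | d , _ , e = ne , d , e

  reordered-picked : ∀ W X rest r →
    pickFirst (maxSize (fragmentsAsc G W X)) (fragmentsAsc G W X) ≡ (rest , just r) → reordered G W X ≡ rest ++ [ r ]
  reordered-picked W X rest r e with pickFirst (maxSize (fragmentsAsc G W X)) (fragmentsAsc G W X) | e
  ... | _ | refl = refl

  reordered-unsplit : ∀ W X → fragmentsAsc G W X ≡ [] → reordered G W X ≡ [ X ]
  reordered-unsplit W X e with fragmentsAsc G W X | e
  ... | _ | refl = refl

  data ReorderedView (W X : Subset n) : Set where
    unsplit  : fragmentsAsc G W X ≡ [] → reordered G W X ≡ [ X ] → ReorderedView W X
    permuted : reordered G W X ↭ fragmentsAsc G W X → ReorderedView W X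

  reorderedView : ∀ W X → ReorderedView W X
  reorderedView W X with fragmentsAsc G W X in eF
  ... | []    = unsplit eF (reordered-unsplit W X eF)
  ... | Y ∷ L with pickFirst-selects (maxSize (Y ∷ L)) (Y ∷ L) (maxSize-attained Y L)
  ...   | rest , r , e , r∷rest↭ = permuted (subst₂ _↭_ (sym reordered≡) (sym eF) (↭.trans (↭-sym (∷↭∷ʳ r rest)) r∷rest↭))
    where
    reordered≡ : reordered G W X ≡ rest ++ [ r ]
    reordered≡ = reordered-picked W X rest r (trans (cong (λ L → pickFirst (maxSize L) L) eF) e)

  cellsContaining-reordered : ∀ W X v → cellsContaining (reordered G W X) v ≡ bit (mem X v)
  cellsContaining-reordered W X v with reorderedView W X
  ... | unsplit _ e rewrite e = +-identityʳ (bit (mem X v))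
  ... | permuted p = trans (cellsContaining-↭ p v) (cellsContaining-fragmentsAsc W X v)

  ∈-reordered⁻ : ∀ W X {Y} → Y ∈ reordered G W X → Y ∈ fragmentsAsc G W X ⊎ (fragmentsAsc G W X ≡ [] × Y ≡ X)
  ∈-reordered⁻ W X Y∈ with reorderedView W X
  ... | unsplit eF e rewrite e with Y∈
  ...   | here Y≡X = inj₂ (eF , Y≡X)
  ∈-reordered⁻ W X Y∈ | permuted p = inj₁ (∈-resp-↭ p Y∈)

  reordered-⊆ : ∀ W X {Y} u → Y ∈ reordered G W X → mem Y u ≡ true → mem X u ≡ true
  reordered-⊆ W X u Y∈ mu with ∈-reordered⁻ W X Y∈
  ... | inj₂ (_ , refl) = mu
  ... | inj₁ Y∈F with ∈-fragmentsAsc⁻ W X Y∈F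
  ...   | _ , d , refl = proj₁ (mem-fragment⁻ W X d u mu)

  reordered-uniform-cells : ∀ W X → Uniform (deg G W) (reordered G W X)
  reordered-uniform-cells W X Y∈ u w mu mw with ∈-reordered⁻ W X Y∈
  ... | inj₂ (eF , refl) = contradiction X-empty λ ()
    where
    X-empty : 0 ≡ bit true
    X-empty = trans (cong (λ L → cellsContaining L u) (sym eF)) (trans (cellsContaining-fragmentsAsc W X u) (cong bit mu))
  ... | inj₁ Y∈F with ∈-fragmentsAsc⁻ W X Y∈F
  ...   | _ , d , refl = trans (proj₂ (mem-fragment⁻ W X d u mu)) (sym (proj₂ (mem-fragment⁻ W X d w mw)))

  reordered-nonempty : ∀ W X → 1 ≤ ∣ X ∣ → All (λ Y → 1 ≤ ∣ Y ∣) (reordered G W X)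
  reordered-nonempty W X ne = All.tabulate nonempty
    where
    nonempty : ∀ {Y} → Y ∈ reordered G W X → 1 ≤ ∣ Y ∣
    nonempty Y∈ with ∈-reordered⁻ W X Y∈
    ... | inj₁ Y∈F        = proj₁ (∈-fragmentsAsc⁻ W X Y∈F)
    ... | inj₂ (_ , refl) = ne

  fragment-of-uniform : ∀ W X {Y} → UniformOn (deg G W) X → Y ∈ fragmentsAsc G W X → Y ≡ X
  fragment-of-uniform W X uniform Y∈ with ∈-fragmentsAsc⁻ W X Y∈
  ... | ne , d , refl with nonempty-witness (fragment W X d) ne
  ...   | y , my = lookup-ext pointwise
    where
    pointwise : ∀ u → mem (fragment W X d) u ≡ mem X u
    pointwise u with mem X u in mu
    ... | false = trans (mem-tabulate _ u) (cong (_∧ _) mu)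
    ... | true  = trans (mem-tabulate _ u) (trans (cong₂ _∧_ mu (cong (_≡ᵇ d) degu≡d)) (cong (true ∧_) (≡ᵇ-refl d)))
      where
      degu≡d : deg G W u ≡ d
      degu≡d = trans (uniform u y mu (proj₁ (mem-fragment⁻ W X d y my))) (proj₂ (mem-fragment⁻ W X d y my))

  reordered-uniform : ∀ W X v → mem X v ≡ true → UniformOn (deg G W) X → reordered G W X ≡ [ X ]
  reordered-uniform W X v mv uniform with reorderedView W X
  ... | unsplit _ e  = e
  ... | permuted p =
    all≡⇒singleton v (fragment-of-uniform W X uniform ∘ ∈-resp-↭ p) mv
      (trans (cellsContaining-reordered W X v) (cong bit mv))

  reordered≡assemble : ∀ W X → reordered G W X ≡
    let (rest , r) = pickFirst (maxSize (fragmentsAsc G W X)) (fragmentsAsc G W X) in rest ++ [ fromMaybe X r ]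
  reordered≡assemble W X with pickFirst (maxSize (fragmentsAsc G W X)) (fragmentsAsc G W X)
  ... | rest , just Y  = refl
  ... | rest , nothing = refl

  cellsContaining-splitBy : ∀ W π v → cellsContaining (splitBy G W π) v ≡ cellsContaining π v
  cellsContaining-splitBy W π v = cellsContaining-concatMap (reordered G W) π v (λ X → cellsContaining-reordered W X v)

  splitBy-isColoring : ∀ W π → IsColoring π → IsColoring (splitBy G W π)
  splitBy-isColoring W π (nonempty , once) =
    nonempty-concatMap π nonempty , λ v → trans (cellsContaining-splitBy W π v) (once v)
    where
    nonempty-concatMap : ∀ π → All (λ S → 1 ≤ ∣ S ∣) π → All (λ S → 1 ≤ ∣ S ∣) (splitBy G W π)
    nonempty-concatMap []      []       = []
    nonempty-concatMap (X ∷ π) (h ∷ hs) = All.++⁺ (reordered-nonempty W X h) (nonempty-concatMap π hs)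

  ∈-splitBy⁻ : ∀ W π {Y} → Y ∈ splitBy G W π → ∃ λ X → X ∈ π × Y ∈ reordered G W X
  ∈-splitBy⁻ W π Y∈ = find (∈-concatMap⁻ (reordered G W) Y∈)

  splitBy-refines : ∀ W π → Refines (splitBy G W π) π
  splitBy-refines W π Y∈ with ∈-splitBy⁻ W π Y∈
  ... | X , X∈ , Y∈X = X , X∈ , λ u → reordered-⊆ W X u Y∈X

  splitBy-uniform-cells : ∀ W π → Uniform (deg G W) (splitBy G W π)
  splitBy-uniform-cells W π Y∈ with ∈-splitBy⁻ W π Y∈
  ... | X , _ , Y∈X = reordered-uniform-cells W X Y∈X

  splitBy-uniform : ∀ W π → All (λ S → 1 ≤ ∣ S ∣) π → Uniform (deg G W) π → splitBy G W π ≡ π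
  splitBy-uniform W []      []         _       = refl
  splitBy-uniform W (X ∷ π) (ne ∷ nes) uniform with nonempty-witness X ne
  ... | v , mv rewrite reordered-uniform W X v mv (uniform (here refl)) =
    cong (X ∷_) (splitBy-uniform W π nes (uniform ∘ there))

  splitBy-⪯ : ∀ W π → splitBy G W π ⪯ π
  splitBy-⪯ W = concatMap-⪯ (reordered G W) (cellsContaining-reordered W)

  length-splitBy : ∀ W π → length π ≤ length (splitBy G W π)
  length-splitBy W []      = z≤n
  length-splitBy W (X ∷ π)
    rewrite length-++ (reordered G W X) {splitBy G W π} | length-++ (others G W X) {[ largest G W X ]}
          | +-comm (length (others G W X)) 1 =
    s≤s (≤-trans (length-splitBy W π) (m≤n+m _ _))

  -- Split chains

  IsEquitable : Coloring n → Set
  IsEquitable π = ∀ i → i < length π → split G π i ≡ π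

  record SplitStep (π π′ : Coloring n) : Set where
    constructor splitStep
    field
      index         : ℕ
      in-range      : index < length π
      changes       : split G π index ≢ π
      earlier-fixed : ∀ j → j < index → split G π j ≡ π
      result        : π′ ≡ split G π index

  _↠_ : Coloring n → Coloring n → Set
  _↠_ = Star SplitStep

  equitable⇒no-step : ∀ {π π′} → IsEquitable π → ¬ SplitStep π π′
  equitable⇒no-step fixed (splitStep i i<len changes _ _) = changes (fixed i i<len)

  splitStep-deterministic : ∀ {π π′ π″} → SplitStep π π′ → SplitStep π π″ → π′ ≡ π″
  splitStep-deterministic (splitStep i _ changes fixed refl) (splitStep i′ _ changes′ fixed′ refl) with <-cmp i i′
  ... | tri< i<i′ _ _ = contradiction (fixed′ i i<i′) changes
  ... | tri≈ _ refl _ = refl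
  ... | tri> _ _ i′<i = contradiction (fixed i′ i′<i) changes′

  ↠-unique : ∀ {π ρ ρ′} → π ↠ ρ → IsEquitable ρ → π ↠ ρ′ → IsEquitable ρ′ → ρ ≡ ρ′
  ↠-unique ε          _  ε            _   = refl
  ↠-unique ε          eq (step ◅ _)   _   = contradiction step (equitable⇒no-step eq)
  ↠-unique (step ◅ _) _  ε            eq′ = contradiction step (equitable⇒no-step eq′)
  ↠-unique (step ◅ r) eq (step′ ◅ r′) eq′ rewrite splitStep-deterministic step step′ = ↠-unique r eq r′ eq′

  ↠-after-step : ∀ {π π′ ρ} → SplitStep π π′ → π ↠ ρ → IsEquitable ρ → π′ ↠ ρ
  ↠-after-step step ε            eq = contradiction step (equitable⇒no-step eq)
  ↠-after-step step (step′ ◅ r) _  rewrite splitStep-deterministic step step′ = r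

  ↠-isColoring : ∀ {π ρ} → π ↠ ρ → IsColoring π → IsColoring ρ
  ↠-isColoring ε                                   c = c
  ↠-isColoring {π} (splitStep i _ _ _ refl ◅ r) c = ↠-isColoring r (splitBy-isColoring (cellAt π i) π c)

  ↠-length : ∀ {π ρ} → π ↠ ρ → length π ≤ length ρ
  ↠-length ε                                 = ≤-refl
  ↠-length {π} (splitStep i _ _ _ refl ◅ r) = ≤-trans (length-splitBy (cellAt π i) π) (↠-length r)

  splitBy≡⇒uniform : ∀ W π → splitBy G W π ≡ π → Uniform (deg G W) π
  splitBy≡⇒uniform W π e X∈ = splitBy-uniform-cells W π (subst (_ ∈_) (sym e) X∈)

  uniform⇒equitable : ∀ π → IsColoring π → (∀ {X} → X ∈ π → Uniform (deg G X) π) → IsEquitable π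
  uniform⇒equitable π (nonempty , _) uniform i i< =
    splitBy-uniform (cellAt π i) π nonempty (uniform (cellAt-∈ π i i<))

  equitable⇒uniform : ∀ π → IsEquitable π → ∀ {X} → X ∈ π → Uniform (deg G X) π
  equitable⇒uniform π equitable X∈ with ∈⇒cellAt π X∈
  ... | i , i< , refl = splitBy≡⇒uniform (cellAt π i) π (equitable i i<)

  -- The loop invariant of make-equitable

  degList : List (Subset n) → Fin n → ℕ
  degList []      u = 0
  degList (X ∷ L) u = deg G X u + degList L u

  degList≡sum : ∀ L u → degList L u ≡ sum (λ v → cellsContaining L v * bit (mem (lookup G u) v))
  degList≡sum []      u = sym (sum-zero n)
    where
    sum-zero : ∀ m → sum {m} (λ _ → 0) ≡ 0
    sum-zero zero    = refl
    sum-zero (suc m) = sum-zero m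
  degList≡sum (X ∷ L) u = begin
      deg G X u + degList L u
    ≡⟨ cong₂ _+_ (trans (∣S∣≡sum (X ∩ N)) (sum-cong-≗ λ v → trans (cong bit (mem-∩ X N v)) (bit-∧ (mem X v) (mem N v))))
                 (degList≡sum L u) ⟩
      sum (λ v → bit (mem X v) * bit (mem N v)) + sum (λ v → cellsContaining L v * bit (mem N v))
    ≡⟨ sym (∑-distrib-+ (λ v → bit (mem X v) * bit (mem N v)) (λ v → cellsContaining L v * bit (mem N v))) ⟩
      sum (λ v → bit (mem X v) * bit (mem N v) + cellsContaining L v * bit (mem N v))
    ≡⟨ sum-cong-≗ (λ v → sym (*-distribʳ-+ (bit (mem N v)) (bit (mem X v)) (cellsContaining L v))) ⟩
      sum (λ v → cellsContaining (X ∷ L) v * bit (mem N v)) ∎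
    where
    open ≡-Reasoning
    N : Subset n
    N = lookup G u

  degList-cong : ∀ L L′ u → (∀ v → cellsContaining L v ≡ cellsContaining L′ v) → degList L u ≡ degList L′ u
  degList-cong L L′ u h = begin
    degList L u                                              ≡⟨ degList≡sum L u ⟩
    sum (λ v → cellsContaining L v * bit (mem (lookup G u) v))  ≡⟨ sum-cong-≗ (λ v → cong (_* _) (h v)) ⟩
    sum (λ v → cellsContaining L′ v * bit (mem (lookup G u) v)) ≡⟨ degList≡sum L′ u ⟨
    degList L′ u                                             ∎
    where open ≡-Reasoning

  degList-uniform : ∀ π ds → (∀ {D} → D ∈ ds → Uniform (deg G D) π) → Uniform (degList ds) π
  degList-uniform π []       _       _  u w _  _  = refl
  degList-uniform π (D ∷ ds) uniform X∈ u w mu mw =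
    cong₂ _+_ (uniform (here refl) X∈ u w mu mw) (degList-uniform π ds (uniform ∘ there) X∈ u w mu mw)

  degList-uniform-cong : ∀ {π} L L′ → (∀ v → cellsContaining L v ≡ cellsContaining L′ v) →
    Uniform (degList L′) π → Uniform (degList L) π
  degList-uniform-cong L L′ same uniform X∈ u w mu mw =
    trans (degList-cong L L′ u same) (trans (uniform X∈ u w mu mw) (sym (degList-cong L L′ w same)))

  BlockInvariant : Coloring n → List (Subset n) → Set
  BlockInvariant π α = ∀ pre C post → π ≡ pre ++ C ∷ post → elemᵇ C α ≡ false →
    ∃₂ λ pre′ ds → pre ≡ pre′ ++ ds × Uniform (degList (C ∷ ds)) π

  record LoopInvariant (π : Coloring n) (α : List (Subset n)) : Set where
    constructor loopInvariant
    field
      isColoring : IsColoring π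
      α⊆π        : All (_∈ π) α
      blocks     : BlockInvariant π α

  unlisted-cell-uniform : ∀ {π α} → LoopInvariant π α → ∀ pre C post → π ≡ pre ++ C ∷ post →
    (∀ {X} → X ∈ pre → Uniform (deg G X) π) → elemᵇ C α ≡ false → Uniform (deg G C) π
  unlisted-cell-uniform {π} inv pre C post π≡ pre-uniform C∉α X∈ u w mu mw
    with LoopInvariant.blocks inv pre C post π≡ C∉α
  ... | pre′ , ds , refl , block-uniform =
    +-cancelʳ-≡ (degList ds u) (deg G C u) (deg G C w)
      (trans (block-uniform X∈ u w mu mw)
        (cong (deg G C w +_) (sym (degList-uniform π ds (pre-uniform ∘ ∈-++⁺ʳ pre′) X∈ u w mu mw))))

  unlisted-prefix-uniform : ∀ {π α} → LoopInvariant π α → ∀ done rest post → π ≡ done ++ rest ++ post →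
    (∀ {X} → X ∈ done → Uniform (deg G X) π) → All (λ X → elemᵇ X α ≡ false) rest →
    ∀ {X} → X ∈ done ++ rest → Uniform (deg G X) π
  unlisted-prefix-uniform inv done []         post π≡ done-uniform []               X∈ =
    done-uniform (subst (_ ∈_) (++-identityʳ done) X∈)
  unlisted-prefix-uniform {π} inv done (C ∷ rest) post π≡ done-uniform (C∉α ∷ rest∉α) X∈ =
    unlisted-prefix-uniform inv (done ++ [ C ]) rest post π≡′ done′-uniform rest∉α
      (subst (_ ∈_) (sym (++-assoc done [ C ] rest)) X∈)
    where
    π≡′ : π ≡ (done ++ [ C ]) ++ rest ++ post
    π≡′ = trans π≡ (sym (++-assoc done [ C ] (rest ++ post)))
    done′-uniform : ∀ {X} → X ∈ done ++ [ C ] → Uniform (deg G X) π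
    done′-uniform X∈ with ∈-++⁻ done X∈
    ... | inj₁ X∈done        = done-uniform X∈done
    ... | inj₂ (here refl)   = unlisted-cell-uniform inv done C (rest ++ post) π≡ done-uniform C∉α

  unlisted-uniform : ∀ {π α} → LoopInvariant π α → ∀ pre post → π ≡ pre ++ post →
    All (λ X → elemᵇ X α ≡ false) pre → ∀ {X} → X ∈ pre → Uniform (deg G X) π
  unlisted-uniform inv pre post π≡ unlisted = unlisted-prefix-uniform inv [] pre post π≡ (λ ()) unlisted

  nextα : Subset n → Coloring n → List (Subset n) → List (Subset n)
  nextα W π α = map (largest G W) (removeAll W α) ++ concatMap (others G W) π

  cellsContaining-others-largest : ∀ W X v →
    cellsContaining (others G W X) v + bit (mem (largest G W X) v) ≡ bit (mem X v)
  cellsContaining-others-largest W X v =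
    trans (cong (cellsContaining (others G W X) v +_) (sym (+-identityʳ _)))
      (trans (sym (cellsContaining-++ (others G W X) [ largest G W X ] v)) (cellsContaining-reordered W X v))

  ∈-splitBy⁺ : ∀ W {π X Y} → X ∈ π → Y ∈ reordered G W X → Y ∈ splitBy G W π
  ∈-splitBy⁺ W X∈ Y∈ = ∈-concatMap⁺ (reordered G W) (lose X∈ Y∈)

  nextα⊆splitBy : ∀ W π α → All (_∈ π) α → All (_∈ splitBy G W π) (nextα W π α)
  nextα⊆splitBy W π α α⊆π = All.++⁺ (All.map⁺ (All.tabulate largest∈)) (All.tabulate others∈)
    where
    largest∈ : ∀ {Y} → Y ∈ removeAll W α → largest G W Y ∈ splitBy G W π
    largest∈ {Y} Y∈ = ∈-splitBy⁺ W {π} (All.lookup α⊆π (∈-removeAll⁻ W α Y∈)) (∈-++⁺ʳ (others G W Y) (here refl))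
    others∈ : ∀ {Z} → Z ∈ concatMap (others G W) π → Z ∈ splitBy G W π
    others∈ Z∈ with find (∈-concatMap⁻ (others G W) {π} Z∈)
    ... | X , X∈ , Z∈others = ∈-splitBy⁺ W {π} X∈ (∈-++⁺ˡ Z∈others)

  splitter-block-uniform : ∀ W π → Uniform (degList (largest G W W ∷ others G W W)) (splitBy G W π)
  splitter-block-uniform W π =
    degList-uniform-cong (largest G W W ∷ others G W W) [ W ] same
      (degList-uniform (splitBy G W π) [ W ] λ { (here refl) → splitBy-uniform-cells W π })
    where
    same : ∀ v → cellsContaining (largest G W W ∷ others G W W) v ≡ cellsContaining [ W ] v
    same v = trans (+-comm (bit (mem (largest G W W) v)) _)
               (trans (cellsContaining-others-largest W W v) (sym (+-identityʳ _)))

  split-block-uniform : ∀ W π X ds → Uniform (degList (X ∷ ds)) π →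
    Uniform (degList (largest G W X ∷ splitBy G W ds ++ others G W X)) (splitBy G W π)
  split-block-uniform W π X ds block-uniform =
    degList-uniform-cong (largest G W X ∷ splitBy G W ds ++ others G W X) (X ∷ ds) same
      (Uniform-refines (splitBy-refines W π) block-uniform)
    where
    same : ∀ v → cellsContaining (largest G W X ∷ splitBy G W ds ++ others G W X) v ≡ cellsContaining (X ∷ ds) v
    same v rewrite cellsContaining-++ (splitBy G W ds) (others G W X) v | cellsContaining-splitBy W ds v =
      trans (cong (bit (mem (largest G W X) v) +_) (+-comm (cellsContaining ds v) _))
        (trans (sym (+-assoc (bit (mem (largest G W X) v)) _ _))
          (cong (_+ cellsContaining ds v)
            (trans (+-comm (bit (mem (largest G W X) v)) _) (cellsContaining-others-largest W X v))))

  BlockInvariant-splitBy : ∀ W {π α} → LoopInvariant π α → BlockInvariant (splitBy G W π) (nextα W π α)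
  BlockInvariant-splitBy W {π} {α} inv pre″ C′ post″ π′≡ C′∉α′ = from-block (locate (reordered G W) π pre″ C′ post″ π′≡)
    where
    π′ : Coloring n
    π′ = splitBy G W π
    α′ : List (Subset n)
    α′ = nextα W π α
    listed : ∀ {Y} → Y ∈ α′ → elemᵇ Y α′ ≡ false → ∃₂ λ pre′ ds → pre″ ≡ pre′ ++ ds × Uniform (degList (C′ ∷ ds)) π′
    listed Y∈ Y∉ = contradiction (trans (sym (∈⇒elemᵇ Y∈)) Y∉) λ ()
    from-block : Located (reordered G W) π pre″ C′ → ∃₂ λ pre′ ds → pre″ ≡ pre′ ++ ds × Uniform (degList (C′ ∷ ds)) π′
    from-block record { before = before ; source = X ; after = after ; inner-before = a ; inner-after = d ∷ ds
                      ; xs≡ = π≡ ; image≡ = reordered≡ } =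
      listed (∈-++⁺ʳ (map (largest G W) (removeAll W α))
               (∈-concatMap⁺ (others G W) (lose (subst (X ∈_) (sym π≡) (∈-insert before))
                 (∷ʳ≡++∷∷⇒∈ (others G W X) (largest G W X) a C′ d ds reordered≡)))) C′∉α′
    from-block record { before = before ; source = X ; after = after ; inner-before = a ; inner-after = []
                      ; xs≡ = π≡ ; image≡ = reordered≡ ; pre≡ = pre≡ }
      with ∷ʳ-injective (others G W X) a reordered≡
    ... | refl , refl with elemᵇ X (removeAll W α) in X∈α₁
    ...   | true  = listed (∈-++⁺ˡ (∈-map⁺ (largest G W) (elemᵇ⇒∈ X (removeAll W α) X∈α₁))) C′∉α′
    ...   | false with ∉-removeAll⁻ W X α X∈α₁
    ...     | inj₂ refl = splitBy G W before , others G W W , pre≡ , splitter-block-uniform W π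
    ...     | inj₁ X∉α with LoopInvariant.blocks inv before X after π≡ X∉α
    ...       | pre₀ , ds₀ , refl , X-block-uniform =
      splitBy G W pre₀ , splitBy G W ds₀ ++ others G W X , pre≡′ , split-block-uniform W π X ds₀ X-block-uniform
      where
      pre≡′ : pre″ ≡ splitBy G W pre₀ ++ (splitBy G W ds₀ ++ others G W X)
      pre≡′ = trans pre≡ (trans (cong (_++ others G W X) (concatMap-++ (reordered G W) pre₀ ds₀))
                (++-assoc (splitBy G W pre₀) (splitBy G W ds₀) (others G W X)))

  LoopInvariant-splitBy : ∀ W {π α} → LoopInvariant π α → LoopInvariant (splitBy G W π) (nextα W π α)
  LoopInvariant-splitBy W {π} {α} inv@(loopInvariant isColoring α⊆π _) =
    loopInvariant (splitBy-isColoring W π isColoring) (nextα⊆splitBy W π α α⊆π) (BlockInvariant-splitBy W inv)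

  length-splitBy-others : ∀ W π → length (splitBy G W π) ≡ length π + length (concatMap (others G W) π)
  length-splitBy-others W []      = refl
  length-splitBy-others W (X ∷ π)
    rewrite length-++ (reordered G W X) {splitBy G W π} | length-++ (others G W X) {[ largest G W X ]}
          | length-splitBy-others W π | length-++ (others G W X) {concatMap (others G W) π}
          | +-comm (length (others G W X)) 1 =
    cong suc (trans (sym (+-assoc o (length π) c)) (trans (cong (_+ c) (+-comm o (length π))) (+-assoc (length π) o c)))
    where
    o c : ℕ
    o = length (others G W X)
    c = length (concatMap (others G W) π)

  loopMeasure-splitBy : ∀ W π α → IsColoring π → W ∈ α → loopMeasure (splitBy G W π) (nextα W π α) < loopMeasure π α
  loopMeasure-splitBy W π α isColoring W∈α
    rewrite length-++ (map (largest G W) (removeAll W α)) {concatMap (others G W) π}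
          | length-map (largest G W) (removeAll W α) | length-splitBy-others W π =
    measure-decreases n _ _ _ _ (length-removeAll-< W α W∈α)
      (subst (_≤ n) (length-splitBy-others W π) (length≤n (splitBy G W π) (splitBy-isColoring W π isColoring)))

  loop-correct : ∀ fuel π α → LoopInvariant π α → loopMeasure π α < fuel →
    π ↠ meLoop fuel G π α × IsEquitable (meLoop fuel G π α)
  loop-correct (suc fuel) π α inv lt with discreteᵇ π in d | firstIn π α in first
  ... | true  | _ = ε , uniform⇒equitable π isColoring (λ _ → discrete⇒uniform π (≡true⇒T d))
    where open LoopInvariant inv
  ... | false | nothing = ε , uniform⇒equitable π isColoring
          (unlisted-uniform inv π [] (sym (++-identityʳ π)) (firstIn-nothing π α first))
    where open LoopInvariant inv
  ... | false | just W with firstIn-just π α first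
  ...   | pre , post , π≡ , pre-unlisted , W-listed =
    prepend (loop-correct fuel (splitBy G W π) (nextα W π α) (LoopInvariant-splitBy W inv)
              (≤-trans (loopMeasure-splitBy W π α isColoring W∈α) (≤-pred lt)))
    where
    open LoopInvariant inv
    W∈α : W ∈ α
    W∈α = elemᵇ⇒∈ W α W-listed
    ρ : Coloring n
    ρ = meLoop fuel G (splitBy G W π) (nextα W π α)
    pre-uniform : ∀ {X} → X ∈ pre → Uniform (deg G X) π
    pre-uniform = unlisted-uniform inv pre (W ∷ post) π≡ pre-unlisted
    W-at : cellAt π (length pre) ≡ W
    W-at = trans (cong (λ π → cellAt π (length pre)) π≡) (cellAt-length pre W post)
    pre<π : length pre < length π
    pre<π = subst (length pre <_) (sym (trans (cong length π≡) (length-++ pre {W ∷ post})))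
              (subst (_≤ length pre + suc (length post)) (+-comm (length pre) 1) (+-monoʳ-≤ (length pre) (s≤s z≤n)))
    earlier-fixed : ∀ j → j < length pre → split G π j ≡ π
    earlier-fixed j j< = splitBy-uniform (cellAt π j) π (proj₁ isColoring)
      (pre-uniform (subst (λ π → cellAt π j ∈ pre) (sym π≡) (cellAt-prefix pre (W ∷ post) j j<)))
    prepend : splitBy G W π ↠ ρ × IsEquitable ρ → π ↠ ρ × IsEquitable ρ
    prepend (chain , equitable) with splitBy G W π ≟ᶜ π
    ... | yes unchanged = subst (_↠ ρ) unchanged chain , equitable
    ... | no changed    =
      splitStep (length pre) pre<π (λ e → changed (trans (cong (λ S → splitBy G S π) (sym W-at)) e)) earlier-fixed
        (cong (λ S → splitBy G S π) (sym W-at)) ◅ chain , equitable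

-- Individualisation

indCell : Fin n → Subset n → List (Subset n)
indCell v S = if mem S v then (if ∣ S ∣ ≡ᵇ 1 then [ S ] else ⁅ v ⁆ ∷ [ S - v ]) else [ S ]

⁅v⁆+[S-v] : ∀ (S : Subset n) v u → mem S v ≡ true → bit (mem ⁅ v ⁆ u) + bit (mem (S - v) u) ≡ bit (mem S u)
⁅v⁆+[S-v] S v u mv with u Fin.≟ v
... | yes refl rewrite mem-⁅⁆-self u | mem-minus-self S u | mv = refl
... | no u≢v   rewrite mem-⁅⁆-other v u u≢v | mem-minus-other S v u u≢v = refl

cellsContaining-indCell : ∀ (v : Fin n) S u → cellsContaining (indCell v S) u ≡ bit (mem S u)
cellsContaining-indCell v S u with mem S v in mv
... | false = +-identityʳ _
... | true with ∣ S ∣ ≡ᵇ 1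
...   | true  = +-identityʳ _
...   | false = trans (cong (bit (mem ⁅ v ⁆ u) +_) (+-identityʳ _)) (⁅v⁆+[S-v] S v u mv)

indCell-⊆ : ∀ (v : Fin n) S {Y} u → Y ∈ indCell v S → mem Y u ≡ true → mem S u ≡ true
indCell-⊆ v S u Y∈ mu with mem S v in mv
indCell-⊆ v S u (here refl) mu | false = mu
... | true with ∣ S ∣ ≡ᵇ 1
indCell-⊆ v S u (here refl)         mu | true | true  = mu
indCell-⊆ v S u (here refl)         mu | true | false rewrite mem-⁅⁆⇒≡ v u mu = mv
indCell-⊆ v S u (there (here refl)) mu | true | false = proj₁ (mem-minus⇒mem S v u mu)

indCell-nonempty : ∀ (v : Fin n) S → 1 ≤ ∣ S ∣ → All (λ Y → 1 ≤ ∣ Y ∣) (indCell v S)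
indCell-nonempty v S ne with mem S v in mv
... | false = ne ∷ []
... | true with ∣ S ∣ ≡ᵇ 1 in S≢1
...   | true  = ne ∷ []
...   | false = ≤-reflexive (sym (∣⁅x⁆∣≡1 v)) ∷ S-v-nonempty ∷ []
  where
  S-v-nonempty : 1 ≤ ∣ S - v ∣
  S-v-nonempty with ∣ S - v ∣ in e
  ... | suc _ = s≤s z≤n
  ... | zero  = contradiction (trans (cong (_≡ᵇ 1) (sym ∣S∣≡1)) S≢1) λ ()
    where
    ∣S∣≡1 : ∣ S ∣ ≡ 1
    ∣S∣≡1 = trans (sym (suc∣S-v∣≡∣S∣ S v mv)) (cong suc e)

indCell-block : ∀ (v : Fin n) X a C b → indCell v X ≡ a ++ C ∷ b → C ≢ ⁅ v ⁆ →
  ∀ u → cellsContaining (C ∷ a) u ≡ cellsContaining [ X ] u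
indCell-block v X a C b e C≢⁅v⁆ u with mem X v in mv
... | false with position-in-[x] a b e
...   | refl , refl = refl
indCell-block v X a C b e C≢⁅v⁆ u | true with ∣ X ∣ ≡ᵇ 1
... | true with position-in-[x] a b e
...   | refl , refl = refl
indCell-block v X a C b e C≢⁅v⁆ u | true | false with position-in-[x,y] a b e
... | inj₁ (refl , refl) = contradiction refl C≢⁅v⁆
... | inj₂ (refl , refl) =
  trans (trans (cong (bit (mem (X - v) u) +_) (+-identityʳ _)) (+-comm (bit (mem (X - v) u)) _))
        (trans (⁅v⁆+[S-v] X v u mv) (sym (+-identityʳ _)))

ind-isColoring : ∀ (π : Coloring n) v → IsColoring π → IsColoring (ind π v)
ind-isColoring π v (nonempty , once) =
  nonempty-ind π nonempty , λ u → trans (cellsContaining-concatMap (indCell v) π u (λ X → cellsContaining-indCell v X u)) (once u)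
  where
  nonempty-ind : ∀ π → All (λ S → 1 ≤ ∣ S ∣) π → All (λ S → 1 ≤ ∣ S ∣) (ind π v)
  nonempty-ind []      []       = []
  nonempty-ind (X ∷ π) (h ∷ hs) = All.++⁺ (indCell-nonempty v X h) (nonempty-ind π hs)

ind-refines : ∀ (π : Coloring n) v → Refines (ind π v) π
ind-refines π v Y∈ with find (∈-concatMap⁻ (indCell v) {π} Y∈)
... | X , X∈ , Y∈X = X , X∈ , λ u → indCell-⊆ v X u Y∈X

⁅v⁆∈ind : ∀ (π : Coloring n) v → IsColoring π → ⁅ v ⁆ ∈ ind π v
⁅v⁆∈ind π v isColoring with cellOf isColoring v
... | S , S∈ , mv = ∈-concatMap⁺ (indCell v) (lose S∈ ⁅v⁆∈indCell)
  where
  ⁅v⁆∈indCell : ⁅ v ⁆ ∈ indCell v S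
  ⁅v⁆∈indCell rewrite mv with ∣ S ∣ ≡ᵇ 1 in S≡1
  ... | true  = here (sym (∣S∣≡1⇒S≡⁅v⁆ S v mv (≡ᵇ≡true⇒≡ _ _ S≡1)))
  ... | false = here refl

1≤length-indCell : ∀ (v : Fin n) X → 1 ≤ length (indCell v X)
1≤length-indCell v X with mem X v
... | false = s≤s z≤n
... | true with ∣ X ∣ ≡ᵇ 1
...   | true  = s≤s z≤n
...   | false = s≤s z≤n

length-ind : ∀ (π : Coloring n) v → length π ≤ length (ind π v)
length-ind []      v = z≤n
length-ind (X ∷ π) v rewrite length-++ (indCell v X) {ind π v} = +-mono-≤ (1≤length-indCell v X) (length-ind π v)

length-ind-< : ∀ (π : Coloring n) v {S} → S ∈ π → mem S v ≡ true → (∣ S ∣ ≡ᵇ 1) ≡ false → length π < length (ind π v)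
length-ind-< (X ∷ π) v (here refl) mv S≢1 rewrite length-++ (indCell v X) {ind π v} | mv | S≢1 =
  s≤s (s≤s (length-ind π v))
length-ind-< (X ∷ π) v (there S∈) mv S≢1 rewrite length-++ (indCell v X) {ind π v} =
  ≤-trans (s≤s (length-ind-< π v S∈ mv S≢1)) (+-monoˡ-≤ _ (1≤length-indCell v X))

module _ {n : ℕ} (G : Graph n) where

  make-equitable-correct : ∀ π α → LoopInvariant G π α → loopMeasure π α ≤ 3 * n →
    _↠_ G π (make-equitable G π α) × IsEquitable G (make-equitable G π α)
  make-equitable-correct π α inv bound = loop-correct G (suc (3 * n)) π α inv (s≤s bound)

  initial-invariant : ∀ π₀ → IsColoring π₀ → LoopInvariant G π₀ π₀
  initial-invariant π₀ isColoring = loopInvariant isColoring (All.tabulate id) all-listed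
    where
    all-listed : BlockInvariant G π₀ π₀
    all-listed pre C post π≡ C∉ = contradiction (trans (sym (∈⇒elemᵇ (subst (C ∈_) (sym π≡) (∈-insert pre)))) C∉) λ ()

  initial-measure : ∀ π₀ → IsColoring π₀ → loopMeasure π₀ π₀ ≤ 3 * n
  initial-measure π₀ isColoring = begin
    ℓ + 2 * (n ∸ ℓ)     ≤⟨ +-monoˡ-≤ (2 * (n ∸ ℓ)) (m≤m+n ℓ (ℓ + 0)) ⟩
    2 * ℓ + 2 * (n ∸ ℓ) ≡⟨ *-distribˡ-+ 2 ℓ (n ∸ ℓ) ⟨
    2 * (ℓ + (n ∸ ℓ))   ≡⟨ cong (2 *_) (m+[n∸m]≡n (length≤n π₀ isColoring)) ⟩
    2 * n               ≤⟨ *-monoˡ-≤ n {2} {3} (s≤s (s≤s z≤n)) ⟩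
    3 * n               ∎
    where
    open ≤-Reasoning
    ℓ : ℕ
    ℓ = length π₀

  ind-invariant : ∀ π v → IsColoring π → IsEquitable G π → LoopInvariant G (ind π v) [ ⁅ v ⁆ ]
  ind-invariant π v isColoring equitable =
    loopInvariant (ind-isColoring π v isColoring) (⁅v⁆∈ind π v isColoring ∷ []) blocks
    where
    blocks : BlockInvariant G (ind π v) [ ⁅ v ⁆ ]
    blocks pre C post π′≡ C∉ = concatMap (indCell v) before , inner-before , pre≡ ,
      degList-uniform-cong G (C ∷ inner-before) [ source ]
        (indCell-block v source inner-before C inner-after image≡ C≢⁅v⁆)
        (degList-uniform G (ind π v) [ source ] λ { (here refl) →
          Uniform-refines (ind-refines π v) (equitable⇒uniform G π equitable (subst (source ∈_) (sym xs≡) (∈-insert before))) })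
      where
      open Located (locate (indCell v) π pre C post π′≡)
      C≢⁅v⁆ : C ≢ ⁅ v ⁆
      C≢⁅v⁆ refl = contradiction (trans (sym (∈⇒elemᵇ {L = [ ⁅ v ⁆ ]} (here refl))) C∉) λ ()

  ind-measure : ∀ π v → loopMeasure (ind π v) [ ⁅ v ⁆ ] ≤ 3 * n
  ind-measure π v = ≤-trans (s≤s (*-monoʳ-≤ 2 (m∸n≤m n (length (ind π v))))) (+-monoˡ-≤ (2 * n) (1≤n v))
    where
    1≤n : Fin n → 1 ≤ n
    1≤n fzero    = s≤s z≤n
    1≤n (fsuc _) = s≤s z≤n

  make-equitable-initial-correct : ∀ π₀ → IsColoring π₀ →
    _↠_ G π₀ (make-equitable G π₀ π₀) × IsEquitable G (make-equitable G π₀ π₀)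
  make-equitable-initial-correct π₀ isColoring =
    make-equitable-correct π₀ π₀ (initial-invariant π₀ isColoring) (initial-measure π₀ isColoring)

  make-equitable-ind-correct : ∀ π v → IsColoring π → IsEquitable G π →
    _↠_ G (ind π v) (make-equitable G (ind π v) [ ⁅ v ⁆ ]) × IsEquitable G (make-equitable G (ind π v) [ ⁅ v ⁆ ])
  make-equitable-ind-correct π v isColoring equitable =
    make-equitable-correct (ind π v) [ ⁅ v ⁆ ] (ind-invariant π v isColoring equitable) (ind-measure π v)

-- Automorphisms

module _ {n : ℕ} (σ : Permutation′ n) where

  mem-actS : ∀ S u → mem (actS σ S) u ≡ mem S (σ ⟨$⟩ˡ u)
  mem-actS S u = mem-tabulate (λ i → mem S (σ ⟨$⟩ˡ i)) u

  mem-actS-image : ∀ S v → mem (actS σ S) (σ ⟨$⟩ʳ v) ≡ mem S v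
  mem-actS-image S v = trans (mem-actS S (σ ⟨$⟩ʳ v)) (cong (mem S) (inverseˡ σ))

  actS-injective : ∀ A B → actS σ A ≡ actS σ B → A ≡ B
  actS-injective A B e = lookup-ext λ v →
    trans (sym (mem-actS-image A v)) (trans (cong (λ S → mem S (σ ⟨$⟩ʳ v)) e) (mem-actS-image B v))

  actC-injective : ∀ π π′ → actC σ π ≡ actC σ π′ → π ≡ π′
  actC-injective []      []        e = refl
  actC-injective (X ∷ π) (X′ ∷ π′) e = cong₂ _∷_ (actS-injective X X′ (∷-injectiveˡ e)) (actC-injective π π′ (∷-injectiveʳ e))

  actS-emptySet : actS σ emptySet ≡ emptySet
  actS-emptySet = lookup-ext λ u → trans (mem-actS emptySet u) (trans (mem-emptySet (σ ⟨$⟩ˡ u)) (sym (mem-emptySet u)))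

  σ⁻¹u≡v⇒u≡σv : ∀ u v → σ ⟨$⟩ˡ u ≡ v → u ≡ σ ⟨$⟩ʳ v
  σ⁻¹u≡v⇒u≡σv u v e = trans (sym (inverseʳ σ)) (cong (σ ⟨$⟩ʳ_) e)

  actS-⁅⁆ : ∀ v → actS σ ⁅ v ⁆ ≡ ⁅ σ ⟨$⟩ʳ v ⁆
  actS-⁅⁆ v = lookup-ext λ u → trans (mem-actS ⁅ v ⁆ u) (pointwise u)
    where
    pointwise : ∀ u → mem ⁅ v ⁆ (σ ⟨$⟩ˡ u) ≡ mem ⁅ σ ⟨$⟩ʳ v ⁆ u
    pointwise u with u Fin.≟ σ ⟨$⟩ʳ v
    ... | yes refl = trans (cong (mem ⁅ v ⁆) (inverseˡ σ)) (trans (mem-⁅⁆-self v) (sym (mem-⁅⁆-self (σ ⟨$⟩ʳ v))))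
    ... | no u≢σv  = trans (mem-⁅⁆-other v _ (u≢σv ∘ σ⁻¹u≡v⇒u≡σv u v)) (sym (mem-⁅⁆-other _ u u≢σv))

  actS-minus : ∀ S v → actS σ (S - v) ≡ actS σ S - (σ ⟨$⟩ʳ v)
  actS-minus S v = lookup-ext λ u → trans (mem-actS (S - v) u) (pointwise u)
    where
    pointwise : ∀ u → mem (S - v) (σ ⟨$⟩ˡ u) ≡ mem (actS σ S - (σ ⟨$⟩ʳ v)) u
    pointwise u with u Fin.≟ σ ⟨$⟩ʳ v
    ... | yes refl = trans (cong (mem (S - v)) (inverseˡ σ)) (trans (mem-minus-self S v) (sym (mem-minus-self (actS σ S) _)))
    ... | no u≢σv  = trans (mem-minus-other S v _ (u≢σv ∘ σ⁻¹u≡v⇒u≡σv u v))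
                       (trans (sym (mem-actS S u)) (sym (mem-minus-other (actS σ S) _ u u≢σv)))

  actS-∩ : ∀ A B → actS σ A ∩ actS σ B ≡ actS σ (A ∩ B)
  actS-∩ A B = lookup-ext λ u → trans (mem-∩ (actS σ A) (actS σ B) u)
    (trans (cong₂ _∧_ (mem-actS A u) (mem-actS B u)) (trans (sym (mem-∩ A B _)) (sym (mem-actS (A ∩ B) u))))

  ∣actS∣ : ∀ S → ∣ actS σ S ∣ ≡ ∣ S ∣
  ∣actS∣ S = begin
    ∣ actS σ S ∣                                   ≡⟨ ∣S∣≡sum (actS σ S) ⟩
    sum (λ i → bit (mem (actS σ S) i))             ≡⟨ sum-cong-≗ (cong bit ∘ mem-actS S) ⟩
    sum (λ i → bit (mem S (σ ⟨$⟩ˡ i)))              ≡⟨ sum-permute (λ i → bit (mem S i)) (Permutation.flip σ) ⟨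
    sum (λ i → bit (mem S i))                      ≡⟨ ∣S∣≡sum S ⟨
    ∣ S ∣                                          ∎
    where open ≡-Reasoning

  cellsContaining-actC : ∀ π u → cellsContaining (actC σ π) u ≡ cellsContaining π (σ ⟨$⟩ˡ u)
  cellsContaining-actC []      u = refl
  cellsContaining-actC (S ∷ π) u = cong₂ _+_ (cong bit (mem-actS S u)) (cellsContaining-actC π u)

  actC-isColoring : ∀ π → IsColoring π → IsColoring (actC σ π)
  actC-isColoring π (nonempty , once) = All.map⁺ (All.map (λ {S} → subst (1 ≤_) (sym (∣actS∣ S))) nonempty) ,
    λ u → trans (cellsContaining-actC π u) (once _)

  cellAt-actC : ∀ π i → cellAt (actC σ π) i ≡ actS σ (cellAt π i)
  cellAt-actC []      i       = sym actS-emptySet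
  cellAt-actC (S ∷ π) zero    = refl
  cellAt-actC (S ∷ π) (suc i) = cellAt-actC π i

  discreteᵇ-actC : ∀ π → discreteᵇ (actC σ π) ≡ discreteᵇ π
  discreteᵇ-actC []      = refl
  discreteᵇ-actC (S ∷ π) = cong₂ _∧_ (cong (_≡ᵇ 1) (∣actS∣ S)) (discreteᵇ-actC π)

  keepNonempty-actS : ∀ L → keepNonempty (map (actS σ) L) ≡ map (actS σ) (keepNonempty L)
  keepNonempty-actS []      = refl
  keepNonempty-actS (S ∷ L) rewrite ∣actS∣ S with ∣ S ∣ ≡ᵇ 0
  ... | true  = keepNonempty-actS L
  ... | false = cong (actS σ S ∷_) (keepNonempty-actS L)

  maxSize-actS : ∀ L → maxSize (map (actS σ) L) ≡ maxSize L
  maxSize-actS []      = refl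
  maxSize-actS (S ∷ L) = cong₂ _⊔_ (∣actS∣ S) (maxSize-actS L)

  pickFirst-actS : ∀ m L → pickFirst m (map (actS σ) L) ≡ Product.map (map (actS σ)) (Maybe.map (actS σ)) (pickFirst m L)
  pickFirst-actS m []      = refl
  pickFirst-actS m (S ∷ L) rewrite ∣actS∣ S with ∣ S ∣ ≡ᵇ m
  ... | true  = refl
  ... | false rewrite pickFirst-actS m L with pickFirst m L
  ...   | rest , r = refl

  module _ (G : Graph n) (σ∈AutG : actG σ G ≡ G) where

    adj-image : ∀ u w → adj G (σ ⟨$⟩ʳ u) (σ ⟨$⟩ʳ w) ≡ adj G u w
    adj-image u w = begin
      adj G (σ ⟨$⟩ʳ u) (σ ⟨$⟩ʳ w)                                   ≡⟨ cong (λ H → adj H (σ ⟨$⟩ʳ u) (σ ⟨$⟩ʳ w)) σ∈AutG ⟨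
      adj (actG σ G) (σ ⟨$⟩ʳ u) (σ ⟨$⟩ʳ w)                          ≡⟨ cong (λ r → lookup r (σ ⟨$⟩ʳ w)) (lookup∘tabulate _ (σ ⟨$⟩ʳ u)) ⟩
      lookup (tabulate (λ j → adj G (σ ⟨$⟩ˡ (σ ⟨$⟩ʳ u)) (σ ⟨$⟩ˡ j))) (σ ⟨$⟩ʳ w) ≡⟨ lookup∘tabulate _ (σ ⟨$⟩ʳ w) ⟩
      adj G (σ ⟨$⟩ˡ (σ ⟨$⟩ʳ u)) (σ ⟨$⟩ˡ (σ ⟨$⟩ʳ w))                   ≡⟨ cong₂ (adj G) (inverseˡ σ) (inverseˡ σ) ⟩
      adj G u w                                                    ∎
      where open ≡-Reasoning

    neighbours-image : ∀ u → lookup G (σ ⟨$⟩ʳ u) ≡ actS σ (lookup G u)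
    neighbours-image u = lookup-ext λ j →
      trans (cong (adj G (σ ⟨$⟩ʳ u)) (sym (inverseʳ σ))) (trans (adj-image u (σ ⟨$⟩ˡ j)) (sym (mem-actS (lookup G u) j)))

    deg-image : ∀ W u → deg G (actS σ W) (σ ⟨$⟩ʳ u) ≡ deg G W u
    deg-image W u = trans (cong (λ N → ∣ actS σ W ∩ N ∣) (neighbours-image u))
                      (trans (cong ∣_∣ (actS-∩ W (lookup G u))) (∣actS∣ (W ∩ lookup G u)))

    deg-actS : ∀ W u → deg G (actS σ W) u ≡ deg G W (σ ⟨$⟩ˡ u)
    deg-actS W u = trans (cong (deg G (actS σ W)) (sym (inverseʳ σ))) (deg-image W (σ ⟨$⟩ˡ u))

    fragment-actS : ∀ W X d → fragment G (actS σ W) (actS σ X) d ≡ actS σ (fragment G W X d)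
    fragment-actS W X d = lookup-ext λ u → begin
      mem (fragment G (actS σ W) (actS σ X) d) u                  ≡⟨ mem-tabulate _ u ⟩
      mem (actS σ X) u ∧ (deg G (actS σ W) u ≡ᵇ d)                ≡⟨ cong₂ (λ a k → a ∧ (k ≡ᵇ d)) (mem-actS X u) (deg-actS W u) ⟩
      mem X (σ ⟨$⟩ˡ u) ∧ (deg G W (σ ⟨$⟩ˡ u) ≡ᵇ d)                 ≡⟨ mem-tabulate _ (σ ⟨$⟩ˡ u) ⟨
      mem (fragment G W X d) (σ ⟨$⟩ˡ u)                           ≡⟨ mem-actS (fragment G W X d) u ⟨
      mem (actS σ (fragment G W X d)) u                          ∎
      where open ≡-Reasoning

    fragmentsAsc-actS : ∀ W X → fragmentsAsc G (actS σ W) (actS σ X) ≡ map (actS σ) (fragmentsAsc G W X)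
    fragmentsAsc-actS W X = trans
      (cong keepNonempty (trans (Listₚ.map-cong (fragment-actS W X) (upTo (suc n))) (Listₚ.map-∘ (upTo (suc n)))))
      (keepNonempty-actS (map (fragment G W X) (upTo (suc n))))

    reordered-actS : ∀ W X → reordered G (actS σ W) (actS σ X) ≡ map (actS σ) (reordered G W X)
    reordered-actS W X
      rewrite reordered≡assemble G (actS σ W) (actS σ X) | reordered≡assemble G W X
            | fragmentsAsc-actS W X | maxSize-actS (fragmentsAsc G W X) | pickFirst-actS (maxSize (fragmentsAsc G W X)) (fragmentsAsc G W X)
      with pickFirst (maxSize (fragmentsAsc G W X)) (fragmentsAsc G W X)
    ... | rest , just Y  = sym (map-++ (actS σ) rest [ Y ])
    ... | rest , nothing = sym (map-++ (actS σ) rest [ X ])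

    splitBy-actC : ∀ W π → splitBy G (actS σ W) (actC σ π) ≡ actC σ (splitBy G W π)
    splitBy-actC W []      = refl
    splitBy-actC W (X ∷ π) = trans (cong₂ _++_ (reordered-actS W X) (splitBy-actC W π))
                               (sym (map-++ (actS σ) (reordered G W X) (splitBy G W π)))

    split-actC : ∀ π i → split G (actC σ π) i ≡ actC σ (split G π i)
    split-actC π i rewrite cellAt-actC π i = splitBy-actC (cellAt π i) π

    IsEquitable-actC : ∀ π → IsEquitable G π → IsEquitable G (actC σ π)
    IsEquitable-actC π equitable i i< =
      trans (split-actC π i) (cong (actC σ) (equitable i (subst (i <_) (length-map (actS σ) π) i<)))

    SplitStep-actC : ∀ {π π′} → SplitStep G π π′ → SplitStep G (actC σ π) (actC σ π′)
    SplitStep-actC {π} (splitStep i i< changes earlier-fixed refl) = splitStep i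
      (subst (i <_) (sym (length-map (actS σ) π)) i<)
      (λ e → changes (actC-injective _ _ (trans (sym (split-actC π i)) e)))
      (λ j j< → trans (split-actC π j) (cong (actC σ) (earlier-fixed j j<)))
      (sym (split-actC π i))

    ↠-actC : ∀ {π ρ} → _↠_ G π ρ → _↠_ G (actC σ π) (actC σ ρ)
    ↠-actC ε            = ε
    ↠-actC (step ◅ rest) = SplitStep-actC step ◅ ↠-actC rest

  indCell-actS : ∀ v S → indCell (σ ⟨$⟩ʳ v) (actS σ S) ≡ map (actS σ) (indCell v S)
  indCell-actS v S rewrite mem-actS-image S v | ∣actS∣ S with mem S v
  ... | false = refl
  ... | true with ∣ S ∣ ≡ᵇ 1
  ...   | true  = refl
  ...   | false = cong₂ (λ a b → a ∷ b ∷ []) (sym (actS-⁅⁆ v)) (sym (actS-minus S v))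

  ind-actC : ∀ π v → ind (actC σ π) (σ ⟨$⟩ʳ v) ≡ actC σ (ind π v)
  ind-actC []      v = refl
  ind-actC (S ∷ π) v = trans (cong₂ _++_ (indCell-actS v S) (ind-actC π v)) (sym (map-++ (actS σ) (indCell v S) (ind π v)))

discrete⇒n≤length : ∀ (π : Coloring n) → IsColoring π → Discrete π → n ≤ length π
discrete⇒n≤length π isColoring d = Finₚ.injective⇒≤ {f = position} injective
  where
  position : Fin _ → Fin (length π)
  position v = Any.index (proj₁ (proj₂ (cellOf isColoring v)))
  cell≡lookup : ∀ v → proj₁ (cellOf isColoring v) ≡ List.lookup π (position v)
  cell≡lookup v = Any.lookup-index (proj₁ (proj₂ (cellOf isColoring v)))
  injective : ∀ {v w} → position v ≡ position w → v ≡ w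
  injective {v} {w} e with cellOf isColoring v | cell≡lookup v | cellOf isColoring w | cell≡lookup w
  ... | Y , Y∈ , mv | eY | Z , Z∈ , mw | eZ =
    ∣S∣≡1⇒mem-unique Y v w (discrete⇒∣X∣≡1 π d Y∈) mv
      (subst (λ S → mem S w ≡ true) (sym (trans eY (trans (cong (List.lookup π) e) (sym eZ)))) mw)

discrete-cellAt : ∀ (π : Coloring n) k → IsColoring π → Discrete π → k < length π → ∃ λ x → cellAt π k ≡ ⁅ x ⁆
discrete-cellAt π k (nonempty , _) d k< with nonempty-witness (cellAt π k) (All.lookup nonempty (cellAt-∈ π k k<))
... | x , mx = x , ∣S∣≡1⇒S≡⁅v⁆ (cellAt π k) x mx (discrete⇒∣X∣≡1 π d (cellAt-∈ π k k<))

firstMem-⁅⁆ : ∀ (v : Fin n) → firstMem ⁅ v ⁆ ≡ just v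
firstMem-⁅⁆ fzero            = refl
firstMem-⁅⁆ {suc n} (fsuc v) rewrite firstMem-⁅⁆ v = refl

elemOr-⁅⁆ : ∀ (v d : Fin n) → elemOr ⁅ v ⁆ d ≡ v
elemOr-⁅⁆ v d rewrite firstMem-⁅⁆ v = refl

module _ {n : ℕ} (σ : Permutation′ n) (G : Graph n) (σ∈AutG : actG σ G ≡ G) where

  discInv-actC : ∀ π → IsColoring π → Discrete π → ∀ i → discInv (actC σ π) i ≡ σ ⟨$⟩ʳ discInv π i
  discInv-actC π isColoring d i
    with discrete-cellAt π (toℕ i) isColoring d (≤-trans (Finₚ.toℕ<n i) (discrete⇒n≤length π isColoring d))
  ... | x , cell≡ = begin
    elemOr (cellAt (actC σ π) (toℕ i)) i ≡⟨ cong (λ S → elemOr S i) (trans (cellAt-actC σ π (toℕ i)) (trans (cong (actS σ) cell≡) (actS-⁅⁆ σ x))) ⟩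
    elemOr ⁅ σ ⟨$⟩ʳ x ⁆ i               ≡⟨ elemOr-⁅⁆ _ i ⟩
    σ ⟨$⟩ʳ x                            ≡⟨ cong (σ ⟨$⟩ʳ_) (trans (cong (λ S → elemOr S i) cell≡) (elemOr-⁅⁆ x i)) ⟨
    σ ⟨$⟩ʳ elemOr (cellAt π (toℕ i)) i  ∎
    where open ≡-Reasoning

  graphBy-actC : ∀ π → IsColoring π → Discrete π → graphBy (actC σ π) G ≡ graphBy π G
  graphBy-actC π isColoring d = tabulate-cong λ i → tabulate-cong λ j →
    trans (cong₂ (adj G) (discInv-actC π isColoring d i) (discInv-actC π isColoring d j)) (adj-image σ G σ∈AutG _ _)

-- Lexicographic orders

module _ {A : Set} {_<_ : A → A → Set} where

  Lex-prefix : ∀ xs y ys → Lex-< _≡_ _<_ xs (xs ++ y ∷ ys)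
  Lex-prefix []       y ys = halt
  Lex-prefix (x ∷ xs) y ys = next refl (Lex-prefix xs y ys)

  Lex-at : ∀ xs {a b} r r′ → a < b → Lex-< _≡_ _<_ (xs ++ a ∷ r) (xs ++ b ∷ r′)
  Lex-at []       r r′ a<b = this a<b
  Lex-at (x ∷ xs) r r′ a<b = next refl (Lex-at xs r r′ a<b)

  Lex-++ : ∀ {xs ys} r r′ → Lex-< _≡_ _<_ xs ys → length xs ≡ length ys → Lex-< _≡_ _<_ (xs ++ r) (ys ++ r′)
  Lex-++ {[]}     {[]}     r r′ (base ()) _
  Lex-++ {x ∷ xs} {y ∷ ys} r r′ (this x<y)    _ = this x<y
  Lex-++ {x ∷ xs} {y ∷ ys} r r′ (next x≡y xs<ys) e = next x≡y (Lex-++ r r′ xs<ys (suc-injective e))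

  Lex-irreflexive : (∀ {x} → ¬ x < x) → ∀ xs → ¬ Lex-< _≡_ _<_ xs xs
  Lex-irreflexive irrefl xs = Lex.<-irreflexive (λ { refl → irrefl }) (Pointwise.refl refl)

  Lex-transitive : Transitive _<_ → Transitive (Lex-< _≡_ _<_)
  Lex-transitive = Lex.<-transitive isEquivalence (resp₂ _<_)

-- The search tree

listsUpTo : ∀ n → ℕ → List (List (Fin n))
listsUpTo n zero    = [ [] ]
listsUpTo n (suc k) = [] ∷ concatMap (λ x → map (x ∷_) (listsUpTo n k)) (List.allFin n)

∈-listsUpTo : ∀ n k (μ : List (Fin n)) → length μ ≤ k → μ ∈ listsUpTo n k
∈-listsUpTo n zero    []      _         = here refl
∈-listsUpTo n (suc k) []      _         = here refl
∈-listsUpTo n (suc k) (x ∷ μ) (s≤s μ≤k) =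
  there (∈-concatMap⁺ (λ x → map (x ∷_) (listsUpTo n k)) (lose (∈-allFin x) (∈-map⁺ (x ∷_) (∈-listsUpTo n k μ μ≤k))))

module Soundness {n : ℕ} {H : Set} (_<H_ : H → H → Set) (<H-isStrictTotalOrder : IsStrictTotalOrder _≡_ _<H_)
  (hash : Graph n → Coloring n → H)
  (hash-invariant : ∀ (σ : Permutation′ n) G π → Undirected G → IsColoring π → hash (actG σ G) (actC σ π) ≡ hash G π)
  (_<G_ : Graph n → Graph n → Set) (<G-isStrictTotalOrder : IsStrictTotalOrder _≡_ _<G_)
  (G : Graph n) (π₀ : Coloring n) (undirected : Undirected G) (π₀-isColoring : IsColoring π₀) where

  open Canon _<H_ hash _<G_ G π₀

  EquitableColoring : Coloring n → Set
  EquitableColoring π = IsColoring π × IsEquitable G π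

  R̄[]-correct : _↠_ G π₀ (R̄ []) × IsEquitable G (R̄ [])
  R̄[]-correct = make-equitable-initial-correct G π₀ π₀-isColoring

  Rstep-correct : ∀ π v → EquitableColoring π → _↠_ G (ind π v) (Rstep π v) × EquitableColoring (Rstep π v)
  Rstep-correct π v (isColoring , π-equitable) with make-equitable-ind-correct G π v isColoring π-equitable
  ... | chain , result-equitable = chain , ↠-isColoring G chain (ind-isColoring π v isColoring) , result-equitable

  R̄-equitable : ∀ ν → EquitableColoring (R̄ ν)
  R̄-equitable ν = go (R̄ []) ν (↠-isColoring G (proj₁ R̄[]-correct) π₀-isColoring , proj₂ R̄[]-correct)
    where
    go : ∀ π ν → EquitableColoring π → EquitableColoring (foldl Rstep π ν)
    go π []      eq = eq
    go π (v ∷ ν) eq = go (Rstep π v) ν (proj₂ (Rstep-correct π v eq))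

  R̄-∷ʳ : ∀ ν v → R̄ (ν ∷ʳ v) ≡ Rstep (R̄ ν) v
  R̄-∷ʳ ν v = Listₚ.foldl-∷ʳ Rstep (R̄ []) v ν

  R̄-∷ʳ-chain : ∀ ν v → _↠_ G (ind (R̄ ν) v) (R̄ (ν ∷ʳ v))
  R̄-∷ʳ-chain ν v = subst (_↠_ G (ind (R̄ ν) v)) (sym (R̄-∷ʳ ν v)) (proj₁ (Rstep-correct (R̄ ν) v (R̄-equitable ν)))

  actν-∷ʳ : ∀ (σ : Permutation′ n) ν w → actν σ (ν ∷ʳ w) ≡ actν σ ν ∷ʳ (σ ⟨$⟩ʳ w)
  actν-∷ʳ σ ν w = map-++ (σ ⟨$⟩ʳ_) ν [ w ]

  firstNonSingleton-actC : ∀ σ π → firstNonSingleton (actC σ π) ≡ actS σ (firstNonSingleton π)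
  firstNonSingleton-actC σ []      = sym (actS-emptySet σ)
  firstNonSingleton-actC σ (S ∷ π) rewrite ∣actS∣ σ S with ∣ S ∣ ≡ᵇ 1
  ... | true  = firstNonSingleton-actC σ π
  ... | false = refl

  module Symmetry (σ : Permutation′ n) (σ∈Aut : Aut G π₀ σ) where

    σ∈AutG : actG σ G ≡ G
    σ∈AutG = proj₁ σ∈Aut

    R̄[]-actC : actC σ (R̄ []) ≡ R̄ []
    R̄[]-actC = ↠-unique G
      (subst (λ π → _↠_ G π (actC σ (R̄ []))) (proj₂ σ∈Aut) (↠-actC σ G σ∈AutG (proj₁ R̄[]-correct)))
      (IsEquitable-actC σ G σ∈AutG (R̄ []) (proj₂ R̄[]-correct)) (proj₁ R̄[]-correct) (proj₂ R̄[]-correct)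

    Rstep-actC : ∀ π v → EquitableColoring π → Rstep (actC σ π) (σ ⟨$⟩ʳ v) ≡ actC σ (Rstep π v)
    Rstep-actC π v eq@(isColoring , π-equitable) = ↠-unique G
      (proj₁ (Rstep-correct (actC σ π) (σ ⟨$⟩ʳ v) σπ-eq)) (proj₂ (proj₂ (Rstep-correct (actC σ π) (σ ⟨$⟩ʳ v) σπ-eq)))
      (subst (λ π′ → _↠_ G π′ (actC σ (Rstep π v))) (sym (ind-actC σ π v)) (↠-actC σ G σ∈AutG (proj₁ (Rstep-correct π v eq))))
      (IsEquitable-actC σ G σ∈AutG (Rstep π v) (proj₂ (proj₂ (Rstep-correct π v eq))))
      where
      σπ-eq : EquitableColoring (actC σ π)
      σπ-eq = actC-isColoring σ π isColoring , IsEquitable-actC σ G σ∈AutG π π-equitable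

    R̄-actν : ∀ ν → R̄ (actν σ ν) ≡ actC σ (R̄ ν)
    R̄-actν ν = trans (cong (λ π → foldl Rstep π (actν σ ν)) (sym R̄[]-actC)) (go (R̄ []) ν (R̄-equitable []))
      where
      go : ∀ π ν → EquitableColoring π → foldl Rstep (actC σ π) (actν σ ν) ≡ actC σ (foldl Rstep π ν)
      go π []      _  = refl
      go π (v ∷ ν) eq rewrite Rstep-actC π v eq = go (Rstep π v) ν (proj₂ (Rstep-correct π v eq))

    mem-T̄-actν : ∀ ν w → mem (T̄ (actν σ ν)) (σ ⟨$⟩ʳ w) ≡ mem (T̄ ν) w
    mem-T̄-actν ν w = trans (cong (λ S → mem S (σ ⟨$⟩ʳ w)) (trans (cong firstNonSingleton (R̄-actν ν)) (firstNonSingleton-actC σ (R̄ ν))))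
                       (mem-actS-image σ (T̄ ν) w)

    inTreeFrom-actν⁺ : ∀ ν τ → inTreeFrom ν τ → inTreeFrom (actν σ ν) (actν σ τ)
    inTreeFrom-actν⁺ ν []      _           = _
    inTreeFrom-actν⁺ ν (w ∷ τ) (w∈T , τ∈) = subst T (sym (mem-T̄-actν ν w)) w∈T ,
      subst (λ ν′ → inTreeFrom ν′ (actν σ τ)) (actν-∷ʳ σ ν w) (inTreeFrom-actν⁺ (ν ∷ʳ w) τ τ∈)

    inTreeFrom-actν⁻ : ∀ ν τ → inTreeFrom (actν σ ν) (actν σ τ) → inTreeFrom ν τ
    inTreeFrom-actν⁻ ν []      _           = _
    inTreeFrom-actν⁻ ν (w ∷ τ) (w∈T , τ∈) = subst T (mem-T̄-actν ν w) w∈T ,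
      inTreeFrom-actν⁻ (ν ∷ʳ w) τ (subst (λ ν′ → inTreeFrom ν′ (actν σ τ)) (sym (actν-∷ʳ σ ν w)) τ∈)

    discreteᵇ-R̄-actν : ∀ ν → discreteᵇ (R̄ (actν σ ν)) ≡ discreteᵇ (R̄ ν)
    discreteᵇ-R̄-actν ν = trans (cong discreteᵇ (R̄-actν ν)) (discreteᵇ-actC σ (R̄ ν))

    Leaf-actν⁺ : ∀ ν → Leaf ν → Leaf (actν σ ν)
    Leaf-actν⁺ ν (ν∈ , d) = inTreeFrom-actν⁺ [] ν ν∈ , subst T (sym (discreteᵇ-R̄-actν ν)) d

    Leaf-actν⁻ : ∀ ν → Leaf (actν σ ν) → Leaf ν
    Leaf-actν⁻ ν (ν∈ , d) = inTreeFrom-actν⁻ [] ν ν∈ , subst T (discreteᵇ-R̄-actν ν) d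

    φFrom-actν : ∀ ν τ → φFrom (actν σ ν) (actν σ τ) ≡ φFrom ν τ
    φFrom-actν ν []      = refl
    φFrom-actν ν (w ∷ τ) = cong₂ _∷_ hash-actν
      (trans (cong (λ ν′ → φFrom ν′ (actν σ τ)) (sym (actν-∷ʳ σ ν w))) (φFrom-actν (ν ∷ʳ w) τ))
      where
      hash-actν : hash G (R̄ (actν σ ν ∷ʳ (σ ⟨$⟩ʳ w))) ≡ hash G (R̄ (ν ∷ʳ w))
      hash-actν = begin
        hash G (R̄ (actν σ ν ∷ʳ (σ ⟨$⟩ʳ w)))         ≡⟨ cong (hash G ∘ R̄) (actν-∷ʳ σ ν w) ⟨
        hash G (R̄ (actν σ (ν ∷ʳ w)))                ≡⟨ cong (hash G) (R̄-actν (ν ∷ʳ w)) ⟩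
        hash G (actC σ (R̄ (ν ∷ʳ w)))                ≡⟨ cong (λ G′ → hash G′ (actC σ (R̄ (ν ∷ʳ w)))) σ∈AutG ⟨
        hash (actG σ G) (actC σ (R̄ (ν ∷ʳ w)))       ≡⟨ hash-invariant σ G (R̄ (ν ∷ʳ w)) undirected (proj₁ (R̄-equitable (ν ∷ʳ w))) ⟩
        hash G (R̄ (ν ∷ʳ w))                         ∎
        where open ≡-Reasoning

    φ̄-actν : ∀ ν → φ̄ (actν σ ν) ≡ φ̄ ν
    φ̄-actν = φFrom-actν []

    Gν-actν : ∀ ν → Discrete (R̄ ν) → Gν (actν σ ν) ≡ Gν ν
    Gν-actν ν d = trans (cong (λ π → graphBy π G) (R̄-actν ν)) (graphBy-actC σ G σ∈AutG (R̄ ν) (proj₁ (R̄-equitable ν)) d)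

  inTreeFrom-++⁻ : ∀ ν τ τ′ → inTreeFrom ν (τ ++ τ′) → inTreeFrom ν τ × inTreeFrom (ν ++ τ) τ′
  inTreeFrom-++⁻ ν []      τ′ τ′∈ = _ , subst (λ ν′ → inTreeFrom ν′ τ′) (sym (++-identityʳ ν)) τ′∈
  inTreeFrom-++⁻ ν (w ∷ τ) τ′ (w∈T , rest) with inTreeFrom-++⁻ (ν ∷ʳ w) τ τ′ rest
  ... | τ∈ , τ′∈ = (w∈T , τ∈) , subst (λ ν′ → inTreeFrom ν′ τ′) (++-assoc ν [ w ] τ) τ′∈

  inTreeFrom-++⁺ : ∀ ν τ τ′ → inTreeFrom ν τ → inTreeFrom (ν ++ τ) τ′ → inTreeFrom ν (τ ++ τ′)
  inTreeFrom-++⁺ ν []      τ′ _            τ′∈ = subst (λ ν′ → inTreeFrom ν′ τ′) (++-identityʳ ν) τ′∈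
  inTreeFrom-++⁺ ν (w ∷ τ) τ′ (w∈T , τ∈) τ′∈ =
    w∈T , inTreeFrom-++⁺ (ν ∷ʳ w) τ τ′ τ∈ (subst (λ ν′ → inTreeFrom ν′ τ′) (sym (++-assoc ν [ w ] τ)) τ′∈)

  φFrom-++ : ∀ ν τ τ′ → φFrom ν (τ ++ τ′) ≡ φFrom ν τ ++ φFrom (ν ++ τ) τ′
  φFrom-++ ν []      τ′ = cong (λ ν′ → φFrom ν′ τ′) (sym (++-identityʳ ν))
  φFrom-++ ν (w ∷ τ) τ′ = cong (_ ∷_) (trans (φFrom-++ (ν ∷ʳ w) τ τ′)
                            (cong (λ ν′ → φFrom (ν ∷ʳ w) τ ++ φFrom ν′ τ′) (++-assoc ν [ w ] τ)))

  φ̄-∷ʳ-++ : ∀ ν v τ → φ̄ ((ν ∷ʳ v) ++ τ) ≡ φ̄ ν ++ hash G (R̄ (ν ∷ʳ v)) ∷ φFrom (ν ∷ʳ v) τ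
  φ̄-∷ʳ-++ ν v τ = trans (φFrom-++ [] (ν ∷ʳ v) τ)
    (trans (cong (_++ φFrom (ν ∷ʳ v) τ) (φFrom-++ [] ν [ v ])) (++-assoc (φ̄ ν) [ hash G (R̄ (ν ∷ʳ v)) ] (φFrom (ν ∷ʳ v) τ)))

  firstNonSingleton-nonsingleton : ∀ π w → mem (firstNonSingleton π) w ≡ true →
    firstNonSingleton π ∈ π × (∣ firstNonSingleton π ∣ ≡ᵇ 1) ≡ false
  firstNonSingleton-nonsingleton []      w h = contradiction (trans (sym (mem-emptySet w)) h) λ ()
  firstNonSingleton-nonsingleton (S ∷ π) w h with ∣ S ∣ ≡ᵇ 1 in S≡1
  ... | true  = Product.map₁ there (firstNonSingleton-nonsingleton π w h)
  ... | false = here refl , S≡1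

  firstNonSingleton-nonempty : ∀ π → All (λ S → 1 ≤ ∣ S ∣) π → ¬ Discrete π → ∃ λ w → mem (firstNonSingleton π) w ≡ true
  firstNonSingleton-nonempty []      _          ¬d = contradiction _ ¬d
  firstNonSingleton-nonempty (S ∷ π) (ne ∷ nes) ¬d with ∣ S ∣ ≡ᵇ 1
  ... | true  = firstNonSingleton-nonempty π nes ¬d
  ... | false = nonempty-witness S ne

  firstNonSingleton≡cellAt : ∀ π i → All (λ S → 1 ≤ ∣ S ∣) π → i < length π → 1 < ∣ cellAt π i ∣ →
    (∀ j → j < i → ∣ cellAt π j ∣ ≤ 1) → firstNonSingleton π ≡ cellAt π i
  firstNonSingleton≡cellAt (S ∷ π) zero    _          _        1<S _ with ∣ S ∣ | 1<S
  ... | suc (suc _) | _       = refl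
  ... | suc zero    | s≤s ()
  firstNonSingleton≡cellAt (S ∷ π) (suc i) (ne ∷ nes) (s≤s i<) 1<Si earlier with ∣ S ∣ | ne | earlier 0 (s≤s z≤n)
  ... | suc zero | _ | _ = firstNonSingleton≡cellAt π i nes i< 1<Si (λ j j< → earlier (suc j) (s≤s j<))
  ... | suc (suc _) | _ | s≤s ()

  T̄-nonsingleton : ∀ ν w → T (mem (T̄ ν) w) → T̄ ν ∈ R̄ ν × (∣ T̄ ν ∣ ≡ᵇ 1) ≡ false
  T̄-nonsingleton ν w w∈T = firstNonSingleton-nonsingleton (R̄ ν) w (T⇒≡true w∈T)

  length-R̄-∷ʳ : ∀ ν w → T (mem (T̄ ν) w) → length (R̄ ν) < length (R̄ (ν ∷ʳ w))
  length-R̄-∷ʳ ν w w∈T with T̄-nonsingleton ν w w∈T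
  ... | T̄∈ , nonsingleton =
    ≤-trans (length-ind-< (R̄ ν) w T̄∈ (T⇒≡true w∈T) nonsingleton) (↠-length G (R̄-∷ʳ-chain ν w))

  length-R̄-++ : ∀ ν τ → inTreeFrom ν τ → length (R̄ ν) + length τ ≤ length (R̄ (ν ++ τ))
  length-R̄-++ ν []      _ rewrite +-identityʳ (length (R̄ ν)) | ++-identityʳ ν = ≤-refl
  length-R̄-++ ν (w ∷ τ) (w∈T , τ∈) = begin
    length (R̄ ν) + suc (length τ)   ≡⟨ +-suc _ _ ⟩
    suc (length (R̄ ν)) + length τ   ≤⟨ +-monoˡ-≤ (length τ) (length-R̄-∷ʳ ν w w∈T) ⟩
    length (R̄ (ν ∷ʳ w)) + length τ  ≤⟨ length-R̄-++ (ν ∷ʳ w) τ τ∈ ⟩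
    length (R̄ ((ν ∷ʳ w) ++ τ))      ≡⟨ cong (length ∘ R̄) (++-assoc ν [ w ] τ) ⟩
    length (R̄ (ν ++ w ∷ τ))         ∎
    where open ≤-Reasoning

  InTree⇒length≤n : ∀ μ → InTree μ → length μ ≤ n
  InTree⇒length≤n μ μ∈ =
    ≤-trans (m≤n+m (length μ) (length (R̄ []))) (≤-trans (length-R̄-++ [] μ μ∈) (length≤n (R̄ μ) (proj₁ (R̄-equitable μ))))

  below-leaf-[] : ∀ ν τ → Discrete (R̄ ν) → inTreeFrom ν τ → τ ≡ []
  below-leaf-[] ν []      _ _           = refl
  below-leaf-[] ν (w ∷ τ) d (w∈T , _) with T̄-nonsingleton ν w w∈T
  ... | T̄∈ , nonsingleton = contradiction (trans (sym nonsingleton) (cong (_≡ᵇ 1) (discrete⇒∣X∣≡1 (R̄ ν) d T̄∈))) λ ()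

  leaf-below : ∀ ν → InTree ν → ∃ λ τ → Leaf (ν ++ τ)
  leaf-below ν ν∈ = go n ν ν∈ (m≤n+m n _)
    where
    go : ∀ k ν → InTree ν → n ≤ length (R̄ ν) + k → ∃ λ τ → Leaf (ν ++ τ)
    go k ν ν∈ n≤ with discreteᵇ (R̄ ν) in d
    ... | true  = [] , subst Leaf (sym (++-identityʳ ν)) (ν∈ , ≡true⇒T d)
    ... | false with firstNonSingleton-nonempty (R̄ ν) (proj₁ (proj₁ (R̄-equitable ν))) (λ t → contradiction (trans (sym d) (T⇒≡true t)) λ ())
    ...   | w , w∈T with k
    ...     | zero   = contradiction (subst (n ≤_) (+-identityʳ _) n≤)
                         (<⇒≱ (≤-trans (length-R̄-∷ʳ ν w (≡true⇒T w∈T)) (length≤n _ (proj₁ (R̄-equitable (ν ∷ʳ w))))))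
    ...     | suc k′ with go k′ (ν ∷ʳ w) (inTreeFrom-++⁺ [] ν [ w ] ν∈ (≡true⇒T w∈T , _))
                            (≤-trans n≤ (subst (_≤ length (R̄ (ν ∷ʳ w)) + k′) (sym (+-suc _ k′))
                              (+-monoˡ-≤ k′ (length-R̄-∷ʳ ν w (≡true⇒T w∈T)))))
    ...       | τ , leaf = w ∷ τ , subst Leaf (++-assoc ν [ w ] τ) leaf

  infix 4 _◁_

  data _◁_ (μ μ′ : List (Fin n)) : Set where
    by-invariant : φ̄ μ <inv φ̄ μ′ → μ ◁ μ′
    by-graph     : φ̄ μ ≡ φ̄ μ′ → Gν μ <G Gν μ′ → μ ◁ μ′
    by-sequence  : φ̄ μ ≡ φ̄ μ′ → Gν μ ≡ Gν μ′ → μ′ <lex μ → μ ◁ μ′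

  Beaten : List (Fin n) → Set
  Beaten μ = ∃ λ μ′ → Leaf μ′ × μ ◁ μ′

  ◁-irreflexive : ∀ μ → ¬ μ ◁ μ
  ◁-irreflexive μ (by-invariant lt)    = Lex-irreflexive (IsStrictTotalOrder.irrefl <H-isStrictTotalOrder refl) (φ̄ μ) lt
  ◁-irreflexive μ (by-graph _ lt)      = IsStrictTotalOrder.irrefl <G-isStrictTotalOrder refl lt
  ◁-irreflexive μ (by-sequence _ _ lt) = Lex-irreflexive (Finₚ.<-irrefl refl) μ lt

  ◁-transitive : ∀ {μ₁ μ₂ μ₃} → μ₁ ◁ μ₂ → μ₂ ◁ μ₃ → μ₁ ◁ μ₃
  ◁-transitive (by-invariant lt)       (by-invariant lt′)       = by-invariant (Lex-transitive (IsStrictTotalOrder.trans <H-isStrictTotalOrder) lt lt′)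
  ◁-transitive (by-invariant lt)       (by-graph e _)           = by-invariant (subst (_ <inv_) e lt)
  ◁-transitive (by-invariant lt)       (by-sequence e _ _)      = by-invariant (subst (_ <inv_) e lt)
  ◁-transitive (by-graph e _)          (by-invariant lt′)       = by-invariant (subst (_<inv _) (sym e) lt′)
  ◁-transitive (by-sequence e _ _)     (by-invariant lt′)       = by-invariant (subst (_<inv _) (sym e) lt′)
  ◁-transitive (by-graph e lt)         (by-graph e′ lt′)        = by-graph (trans e e′) (IsStrictTotalOrder.trans <G-isStrictTotalOrder lt lt′)
  ◁-transitive (by-graph e lt)         (by-sequence e′ g′ _)    = by-graph (trans e e′) (subst (_ <G_) g′ lt)
  ◁-transitive (by-sequence e g _)     (by-graph e′ lt′)        = by-graph (trans e e′) (subst (_<G _) (sym g) lt′)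
  ◁-transitive (by-sequence e g lt)    (by-sequence e′ g′ lt′)  =
    by-sequence (trans e e′) (trans g g′) (Lex-transitive Finₚ.<-trans lt′ lt)

  no-leaf-beats : ∀ ν → (∀ μ → Leaf μ → μ ≢ ν → Beaten μ) → ∀ μ → Leaf μ → ¬ ν ◁ μ
  no-leaf-beats ν others-beaten μ μ-leaf ν◁μ = repetition (Finₚ.pigeonhole (n<1+n (length candidates)) position)
    where
    Better : Set
    Better = Σ (List (Fin n)) λ μ → Leaf μ × ν ◁ μ
    improve : (x : Better) → Σ Better λ y → proj₁ x ◁ proj₁ y
    improve (μ , μ-leaf , ν◁μ) with others-beaten μ μ-leaf (λ { refl → ◁-irreflexive ν ν◁μ })
    ... | μ′ , μ′-leaf , μ◁μ′ = (μ′ , μ′-leaf , ◁-transitive ν◁μ μ◁μ′) , μ◁μ′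
    chain : ℕ → Better
    chain zero    = μ , μ-leaf , ν◁μ
    chain (suc k) = proj₁ (improve (chain k))
    node : ℕ → List (Fin n)
    node k = proj₁ (chain k)
    chain-increasing : ∀ i j → i < j → node i ◁ node j
    chain-increasing i (suc j) (s≤s i≤j) with m≤n⇒m<n∨m≡n i≤j
    ... | inj₁ i<j  = ◁-transitive (chain-increasing i j i<j) (proj₂ (improve (chain j)))
    ... | inj₂ refl = proj₂ (improve (chain i))
    candidates : List (List (Fin n))
    candidates = listsUpTo n n
    node∈ : ∀ k → node k ∈ candidates
    node∈ k = ∈-listsUpTo n n (node k) (InTree⇒length≤n (node k) (proj₁ (proj₁ (proj₂ (chain k)))))
    position : Fin (suc (length candidates)) → Fin (length candidates)
    position k = Any.index (node∈ (toℕ k))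
    repetition : ¬ ∃₂ λ i j → i Fin.< j × position i ≡ position j
    repetition (i , j , i<j , same) = ◁-irreflexive (node (toℕ i))
      (subst (node (toℕ i) ◁_) (sym (trans (Any.lookup-index (node∈ (toℕ i)))
        (trans (cong (List.lookup candidates) same) (sym (Any.lookup-index (node∈ (toℕ j)))))))
        (chain-increasing (toℕ i) (toℕ j) i<j))

  unbeaten⇒canonical : ∀ ν → Leaf ν → (∀ μ → Leaf μ → μ ≢ ν → Beaten μ) → CanonicalLeaf ν
  unbeaten⇒canonical ν ν-leaf others-beaten =
    (ν-leaf , λ μ μ-leaf lt → unbeaten μ μ-leaf (by-invariant lt)) ,
    (λ μ μ-max lt → unbeaten μ (proj₁ μ-max) (by-graph (same-invariant μ μ-max) lt)) ,
    (λ μ μ-max same-graph lt → unbeaten μ (proj₁ μ-max) (by-sequence (same-invariant μ μ-max) (sym same-graph) lt))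
    where
    unbeaten : ∀ μ → Leaf μ → ¬ ν ◁ μ
    unbeaten = no-leaf-beats ν others-beaten
    same-invariant : ∀ μ → MaximalLeaf μ → φ̄ ν ≡ φ̄ μ
    same-invariant μ (μ-leaf , μ-max) with Lex.<-compare sym (IsStrictTotalOrder.compare <H-isStrictTotalOrder) (φ̄ ν) (φ̄ μ)
    ... | tri< lt _ _ = contradiction (by-invariant lt) (unbeaten μ μ-leaf)
    ... | tri≈ _ eq _ = Pointwise.Pointwise-≡⇒≡ eq
    ... | tri> _ _ gt = contradiction gt (μ-max ν ν-leaf)

  Twins : List (Fin n) → List (Fin n) → Set
  Twins μ μ′ = Leaf μ′ × φ̄ μ ≡ φ̄ μ′ × Gν μ ≡ Gν μ′

  Simulated : List (Fin n) → List (Fin n) → Set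
  Simulated ν ν′ = ∀ τ → Leaf (ν ++ τ) → ∃ λ τ′ → Twins (ν ++ τ) (ν′ ++ τ′)

  Simulated-refl : ∀ ν → Simulated ν ν
  Simulated-refl ν τ leaf = τ , leaf , refl , refl

  Simulated-trans : ∀ {ν₁ ν₂ ν₃} → Simulated ν₁ ν₂ → Simulated ν₂ ν₃ → Simulated ν₁ ν₃
  Simulated-trans sim₁₂ sim₂₃ τ leaf with sim₁₂ τ leaf
  ... | τ′ , leaf′ , φ≡ , G≡ with sim₂₃ τ′ leaf′
  ...   | τ″ , leaf″ , φ≡′ , G≡′ = τ″ , leaf″ , trans φ≡ φ≡′ , trans G≡ G≡′

  module _ (σ : Permutation′ n) (σ∈Aut : Aut G π₀ σ) where
    open Symmetry σ σ∈Aut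

    automorphism-twins : ∀ μ → Leaf μ → Twins μ (actν σ μ)
    automorphism-twins μ leaf = Leaf-actν⁺ μ leaf , sym (φ̄-actν μ) , sym (Gν-actν μ (proj₂ leaf))

    actν-inverse : ∀ τ → actν σ (map (σ ⟨$⟩ˡ_) τ) ≡ τ
    actν-inverse []      = refl
    actν-inverse (x ∷ τ) = cong₂ _∷_ (inverseʳ σ) (actν-inverse τ)

    automorphism-twins⁻ : ∀ μ μ′ → actν σ μ′ ≡ μ → Leaf μ → Twins μ μ′
    automorphism-twins⁻ μ μ′ refl leaf with Leaf-actν⁻ μ′ leaf
    ... | leaf′ = leaf′ , φ̄-actν μ′ , Gν-actν μ′ (proj₂ leaf′)

    automorphism-simulated : ∀ ν ν′ → actν σ ν ≡ ν′ → Simulated ν ν′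
    automorphism-simulated ν ν′ e τ leaf =
      actν σ τ , subst (λ μ → Twins (ν ++ τ) μ) image≡ (automorphism-twins (ν ++ τ) leaf)
      where
      image≡ : actν σ (ν ++ τ) ≡ ν′ ++ actν σ τ
      image≡ = trans (map-++ (σ ⟨$⟩ʳ_) ν τ) (cong (_++ actν σ τ) e)

    automorphism-simulated⁻ : ∀ ν ν′ → actν σ ν ≡ ν′ → Simulated ν′ ν
    automorphism-simulated⁻ ν ν′ e τ′ leaf = map (σ ⟨$⟩ˡ_) τ′ , automorphism-twins⁻ (ν′ ++ τ′) (ν ++ map (σ ⟨$⟩ˡ_) τ′) image≡ leaf
      where
      image≡ : actν σ (ν ++ map (σ ⟨$⟩ˡ_) τ′) ≡ ν′ ++ τ′
      image≡ = trans (map-++ (σ ⟨$⟩ʳ_) ν (map (σ ⟨$⟩ˡ_) τ′)) (cong₂ _++_ e (actν-inverse τ′))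

  -- Soundness of the rules

  Extends : List (Fin n) → List (Fin n) → Set
  Extends ν μ = ∃ λ τ → μ ≡ ν ++ τ

  extends? : ∀ ν μ → Dec (Extends ν μ)
  extends? []      μ       = yes (μ , refl)
  extends? (x ∷ ν) []      = no λ ()
  extends? (x ∷ ν) (y ∷ μ) with y Fin.≟ x | extends? ν μ
  ... | yes refl | yes (τ , μ≡) = yes (τ , cong (x ∷_) μ≡)
  ... | yes refl | no ¬ext      = no λ { (τ , e) → ¬ext (τ , ∷-injectiveʳ e) }
  ... | no y≢x   | _            = no λ { (τ , e) → y≢x (∷-injectiveˡ e) }

  Pruned : List (Fin n) → Set
  Pruned ν = ∀ μ → Leaf μ → Extends ν μ → Beaten μ

  OnPath : List (Fin n) → Set
  OnPath ν = ∀ μ → Leaf μ → ¬ Extends ν μ → Beaten μ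

  Interchangeable : Subset n → List (Fin n) → Set
  Interchangeable Ω ν = ∀ a b → T (mem Ω a) → T (mem Ω b) → Simulated (ν ∷ʳ a) (ν ∷ʳ b)

  ++-∷-∷ʳ : ∀ (ν : List (Fin n)) w τ → ν ++ w ∷ τ ≡ (ν ∷ʳ w) ++ τ
  ++-∷-∷ʳ ν w τ = sym (++-assoc ν [ w ] τ)

  leaf-through-child : ∀ ν τ → Leaf (ν ++ τ) → ¬ Discrete (R̄ ν) →
    ∃₂ λ w τ′ → τ ≡ w ∷ τ′ × T (mem (T̄ ν) w)
  leaf-through-child ν []      (_ , d)    ¬d = contradiction (subst (Discrete ∘ R̄) (++-identityʳ ν) d) ¬d
  leaf-through-child ν (w ∷ τ) (ν∈ , _) _  = w , τ , refl , proj₁ (proj₂ (inTreeFrom-++⁻ [] ν (w ∷ τ) ν∈))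

  splitColoring-sound : ∀ {ν π} i → i < length π → split G π i ≺ π → (∀ j → j < i → ¬ split G π j ≺ π) →
    _↠_ G π (R̄ ν) → _↠_ G (split G π i) (R̄ ν)
  splitColoring-sound {ν} {π} i i< (_ , changes) earlier-unchanged chain =
    ↠-after-step G (splitStep i i< changes earlier-fixed refl) chain (proj₂ (R̄-equitable ν))
    where
    earlier-fixed : ∀ j → j < i → split G π j ≡ π
    earlier-fixed j j< with split G π j ≟ᶜ π
    ... | yes e = e
    ... | no ne = contradiction (splitBy-⪯ G (cellAt π j) π , ne) (earlier-unchanged j j<)

  targetCell-sound : ∀ ν i → i < length (R̄ ν) → 1 < ∣ cellAt (R̄ ν) i ∣ → (∀ j → j < i → ∣ cellAt (R̄ ν) j ∣ ≤ 1) →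
    cellAt (R̄ ν) i ≡ T̄ ν × ¬ Discrete (R̄ ν)
  targetCell-sound ν i i< 1<size earlier =
    sym (firstNonSingleton≡cellAt (R̄ ν) i (proj₁ (proj₁ (R̄-equitable ν))) i< 1<size earlier) ,
    λ d → <⇒≢ 1<size (sym (discrete⇒∣X∣≡1 (R̄ ν) d (cellAt-∈ (R̄ ν) i i<)))

  mergeOrbits-sound : ∀ {Ω₁ Ω₂ ν} σ w₁ w₂ → Aut G π₀ σ → actν σ ν ≡ ν → T (mem Ω₁ w₁) → T (mem Ω₂ w₂) →
    σ ⟨$⟩ʳ w₁ ≡ w₂ → Interchangeable Ω₁ ν → Interchangeable Ω₂ ν → Interchangeable (Ω₁ ∪ Ω₂) ν
  mergeOrbits-sound {Ω₁} {Ω₂} {ν} σ w₁ w₂ σ∈Aut σν≡ν w₁∈ w₂∈ σw₁≡w₂ inter₁ inter₂ a b a∈ b∈ =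
    combine (side a a∈) (side b b∈)
    where
    side : ∀ x → T (mem (Ω₁ ∪ Ω₂) x) → T (mem Ω₁ x) ⊎ T (mem Ω₂ x)
    side x x∈ = Equivalence.to T-∨ (subst T (mem-∪ Ω₁ Ω₂ x) x∈)
    image≡ : actν σ (ν ∷ʳ w₁) ≡ ν ∷ʳ w₂
    image≡ = trans (actν-∷ʳ σ ν w₁) (cong₂ _∷ʳ_ σν≡ν σw₁≡w₂)
    w₁→w₂ : Simulated (ν ∷ʳ w₁) (ν ∷ʳ w₂)
    w₁→w₂ = automorphism-simulated σ σ∈Aut (ν ∷ʳ w₁) (ν ∷ʳ w₂) image≡
    w₂→w₁ : Simulated (ν ∷ʳ w₂) (ν ∷ʳ w₁)
    w₂→w₁ = automorphism-simulated⁻ σ σ∈Aut (ν ∷ʳ w₁) (ν ∷ʳ w₂) image≡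
    combine : T (mem Ω₁ a) ⊎ T (mem Ω₂ a) → T (mem Ω₁ b) ⊎ T (mem Ω₂ b) → Simulated (ν ∷ʳ a) (ν ∷ʳ b)
    combine (inj₁ a∈₁) (inj₁ b∈₁) = inter₁ a b a∈₁ b∈₁
    combine (inj₂ a∈₂) (inj₂ b∈₂) = inter₂ a b a∈₂ b∈₂
    combine (inj₁ a∈₁) (inj₂ b∈₂) = Simulated-trans (inter₁ a w₁ a∈₁ w₁∈) (Simulated-trans w₁→w₂ (inter₂ w₂ b w₂∈ b∈₂))
    combine (inj₂ a∈₂) (inj₁ b∈₁) = Simulated-trans (inter₂ a w₂ a∈₂ w₂∈) (Simulated-trans w₂→w₁ (inter₁ w₁ b w₁∈ b∈₁))

  pruneInvariant-sound : ∀ {ν′ ν″ v′ v″} → hash G (R̄ (ν″ ∷ʳ v″)) <H hash G (R̄ (ν′ ∷ʳ v′)) → φ̄ ν′ ≡ φ̄ ν″ →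
    InTree (ν′ ∷ʳ v′) → Pruned (ν″ ∷ʳ v″)
  pruneInvariant-sound {ν′} {ν″} {v′} {v″} lt φ≡ ν′v′∈ _ _ (τ , refl) with leaf-below (ν′ ∷ʳ v′) ν′v′∈
  ... | τ′ , leaf′ = (ν′ ∷ʳ v′) ++ τ′ , leaf′ , by-invariant smaller
    where
    smaller : φ̄ ((ν″ ∷ʳ v″) ++ τ) <inv φ̄ ((ν′ ∷ʳ v′) ++ τ′)
    smaller rewrite φ̄-∷ʳ-++ ν″ v″ τ | φ̄-∷ʳ-++ ν′ v′ τ′ | φ≡ = Lex-at (φ̄ ν″) _ _ lt

  pruneLeaf-sound : ∀ {ν′ ν″} → Discrete (R̄ ν″) → (¬ Discrete (R̄ ν′) ⊎ Gν ν″ <G Gν ν′) →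
    InTree ν′ → φ̄ ν′ ≡ φ̄ ν″ → Pruned ν″
  pruneLeaf-sound {ν′} {ν″} d″ worse ν′∈ φ≡ _ leaf (τ , refl)
    with below-leaf-[] ν″ τ d″ (proj₂ (inTreeFrom-++⁻ [] ν″ τ (proj₁ leaf)))
  ... | refl rewrite ++-identityʳ ν″ with leaf-below ν′ ν′∈
  ...   | [] , leaf′ rewrite ++-identityʳ ν′ with worse
  ...     | inj₁ ¬d′ = contradiction (proj₂ leaf′) ¬d′
  ...     | inj₂ lt  = ν′ , leaf′ , by-graph (sym φ≡) lt
  pruneLeaf-sound {ν′} {ν″} d″ worse ν′∈ φ≡ _ leaf (τ , refl) | refl | t ∷ τ′ , leaf′ =
    ν′ ++ t ∷ τ′ , leaf′ , by-invariant longer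
    where
    longer : φ̄ ν″ <inv φ̄ (ν′ ++ t ∷ τ′)
    longer rewrite φFrom-++ [] ν′ (t ∷ τ′) | φ≡ = Lex-prefix (φ̄ ν″) _ _

  pruneAutomorphism-sound : ∀ ν′ ν″ σ → ν′ <lex ν″ → Aut G π₀ σ → actν σ ν′ ≡ ν″ → Pruned ν″
  pruneAutomorphism-sound ν′ ν″ σ lt σ∈Aut σν′≡ν″ _ leaf (τ , refl)
    with automorphism-simulated⁻ σ σ∈Aut ν′ ν″ σν′≡ν″ τ leaf
  ... | τ′ , leaf′ , φ≡ , G≡ =
    ν′ ++ τ′ , leaf′ , by-sequence φ≡ G≡ (Lex-++ τ′ τ lt (trans (sym (length-map (σ ⟨$⟩ʳ_) ν′)) (cong length σν′≡ν″)))

  pruneOrbits-sound : ∀ {Ω ν} w₁ w₂ → T (mem Ω w₂) → T (mem Ω w₁) → w₁ Fin.< w₂ →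
    Interchangeable Ω ν → Pruned (ν ∷ʳ w₂)
  pruneOrbits-sound {Ω} {ν} w₁ w₂ w₂∈ w₁∈ w₁<w₂ inter _ leaf (τ , refl) with inter w₂ w₁ w₂∈ w₁∈ τ leaf
  ... | τ′ , leaf′ , φ≡ , G≡ = (ν ∷ʳ w₁) ++ τ′ , leaf′ , by-sequence φ≡ G≡ smaller
    where
    smaller : ((ν ∷ʳ w₁) ++ τ′) <lex ((ν ∷ʳ w₂) ++ τ)
    smaller rewrite ++-assoc ν [ w₁ ] τ′ | ++-assoc ν [ w₂ ] τ = Lex-at ν τ′ τ w₁<w₂

  pruneParent-sound : ∀ {ν W} → W ≡ T̄ ν → ¬ Discrete (R̄ ν) → (∀ w → T (mem W w) → Pruned (ν ∷ʳ w)) → Pruned ν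
  pruneParent-sound {ν} refl ¬d children-pruned μ leaf (τ , refl) with leaf-through-child ν τ leaf ¬d
  ... | w , τ′ , refl , w∈T = children-pruned w w∈T (ν ++ w ∷ τ′) leaf (τ′ , ++-∷-∷ʳ ν w τ′)

  extendPath-sound : ∀ {ν W} w → OnPath ν → W ≡ T̄ ν → ¬ Discrete (R̄ ν) →
    (∀ w′ → T (mem W w′) → w′ ≢ w → Pruned (ν ∷ʳ w′)) → OnPath (ν ∷ʳ w)
  extendPath-sound {ν} w on-path refl ¬d siblings-pruned μ leaf ¬ext with extends? ν μ
  ... | no ¬ext-ν = on-path μ leaf ¬ext-ν
  ... | yes (τ , refl) with leaf-through-child ν τ leaf ¬d
  ...   | w′ , τ′ , refl , w′∈T with w′ Fin.≟ w
  ...     | yes refl = contradiction (τ′ , ++-∷-∷ʳ ν w τ′) ¬ext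
  ...     | no w′≢w  = siblings-pruned w′ w′∈T w′≢w (ν ++ w′ ∷ τ′) leaf (τ′ , ++-∷-∷ʳ ν w′ τ′)

  canonicalLeaf-sound : ∀ {ν} → Discrete (R̄ ν) → OnPath ν → InTree ν →
    IsCanonicalForm (graphBy (R̄ ν) G) (colBy (R̄ ν) π₀)
  canonicalLeaf-sound {ν} d on-path ν∈ = ν , unbeaten⇒canonical ν (ν∈ , d) others-beaten , refl , refl
    where
    others-beaten : ∀ μ → Leaf μ → μ ≢ ν → Beaten μ
    others-beaten μ leaf μ≢ν with extends? ν μ
    ... | no ¬ext = on-path μ leaf ¬ext
    ... | yes (τ , refl) with below-leaf-[] ν τ d (proj₂ (inTreeFrom-++⁻ [] ν τ (proj₁ leaf)))
    ...   | refl = contradiction (++-identityʳ ν) μ≢ν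

  invariantsEqual-sound : ∀ {ν′ ν″ v′ v″} → φ̄ ν′ ≡ φ̄ ν″ → hash G (R̄ (ν′ ∷ʳ v′)) ≡ hash G (R̄ (ν″ ∷ʳ v″)) →
    φ̄ (ν′ ∷ʳ v′) ≡ φ̄ (ν″ ∷ʳ v″)
  invariantsEqual-sound {ν′} {ν″} {v′} {v″} φ≡ hash≡ = begin
    φ̄ (ν′ ∷ʳ v′)                         ≡⟨ φFrom-++ [] ν′ [ v′ ] ⟩
    φ̄ ν′ ++ [ hash G (R̄ (ν′ ∷ʳ v′)) ]   ≡⟨ cong₂ (λ φ h → φ ++ [ h ]) φ≡ hash≡ ⟩
    φ̄ ν″ ++ [ hash G (R̄ (ν″ ∷ʳ v″)) ]   ≡⟨ φFrom-++ [] ν″ [ v″ ] ⟨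
    φ̄ (ν″ ∷ʳ v″)                         ∎
    where open ≡-Reasoning

  ⟦_⟧ : Fact n → Set
  ⟦ R= ν π ⟧        = InTree ν × π ≡ R̄ ν
  ⟦ R⪯ ν π ⟧        = InTree ν × _↠_ G π (R̄ ν)
  ⟦ T= ν W ⟧        = InTree ν × W ≡ T̄ ν × ¬ Discrete (R̄ ν)
  ⟦ orbit Ω ν ⟧     = Interchangeable Ω ν
  ⟦ φ= ν′ ν″ ⟧      = φ̄ ν′ ≡ φ̄ ν″
  ⟦ pruned ν ⟧      = Pruned ν
  ⟦ onPath ν ⟧      = OnPath ν
  ⟦ canon G′ π′ ⟧   = IsCanonicalForm G′ π′

  sound : ∀ {f} → Derivable f → ⟦ f ⟧
  sound coloringAxiom = _ , proj₁ R̄[]-correct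
  sound (individualize {ν} v ν∈ d) with sound d
  ... | _ , refl = ν∈ , R̄-∷ʳ-chain ν v
  sound (splitColoring {ν} i i< changes earlier d) with sound d
  ... | ν∈ , chain = ν∈ , splitColoring-sound {ν} i i< changes earlier chain
  sound (equitable {ν} π-equitable d) with sound d
  ... | ν∈ , chain = ν∈ , ↠-unique G ε π-equitable chain (proj₂ (R̄-equitable ν))
  sound (targetCell {ν} i i< 1<size earlier d) with sound d
  ... | ν∈ , refl = ν∈ , targetCell-sound ν i i< 1<size earlier
  sound (invariantAxiom ν) = refl
  sound (invariantsEqual hash≡ d d′ d″) with sound d | sound d′ | sound d″
  ... | φ≡ | _ , refl | _ , refl = invariantsEqual-sound φ≡ hash≡
  sound (invariantsEqualSym d) = sym (sound d)
  sound (orbitsAxiom v ν) a b a∈ b∈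
    rewrite mem-⁅⁆⇒≡ v a (T⇒≡true a∈) | mem-⁅⁆⇒≡ v b (T⇒≡true b∈) = Simulated-refl (ν ∷ʳ v)
  sound (mergeOrbits {Ω₁} {Ω₂} {ν} σ w₁ w₂ σ∈Aut σν≡ν w₁∈ w₂∈ σw₁≡w₂ d d′) =
    mergeOrbits-sound {Ω₁} {Ω₂} {ν} σ w₁ w₂ σ∈Aut σν≡ν w₁∈ w₂∈ σw₁≡w₂ (sound d) (sound d′)
  sound (pruneInvariant lt d d′ d″) with sound d | sound d′ | sound d″
  ... | φ≡ | ν′v′∈ , refl | _ , refl = pruneInvariant-sound lt φ≡ ν′v′∈
  sound (pruneLeaf d″ worse d₁ d₂ d₃) with sound d₁ | sound d₂ | sound d₃
  ... | ν′∈ , refl | _ , refl | φ≡ = pruneLeaf-sound d″ worse ν′∈ φ≡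
  sound (pruneAutomorphism ν′ ν″ σ lt σ∈Aut σν′≡ν″) = pruneAutomorphism-sound ν′ ν″ σ lt σ∈Aut σν′≡ν″
  sound (pruneOrbits {Ω} {ν} w₁ w₂ w₂∈ w₁∈ w₁<w₂ d) = pruneOrbits-sound {Ω} {ν} w₁ w₂ w₂∈ w₁∈ w₁<w₂ (sound d)
  sound (pruneParent d children) with sound d
  ... | _ , W≡ , ¬d = pruneParent-sound W≡ ¬d (λ w w∈ → sound (children w w∈))
  sound pathAxiom μ _ ¬ext = contradiction (μ , refl) ¬ext
  sound (extendPath w d d′ siblings) with sound d′
  ... | _ , W≡ , ¬d = extendPath-sound w (sound d) W≡ ¬d (λ w′ w′∈ w′≢w → sound (siblings w′ w′∈ w′≢w))
  sound (canonicalLeaf d on-path d′) with sound d′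
  ... | ν∈ , refl = canonicalLeaf-sound d (sound on-path) ν∈

theorem4p14 : {n : ℕ} {H : Set}
    (_<H_ : H → H → Set) → IsStrictTotalOrder _≡_ _<H_ →
    (hash : Graph n → Coloring n → H) →
    (∀ (σ : Permutation′ n) G π → Undirected G → IsColoring π →
       hash (actG σ G) (actC σ π) ≡ hash G π) →
    (_<G_ : Graph n → Graph n → Set) → IsStrictTotalOrder _≡_ _<G_ →
    (G : Graph n) (π₀ : Coloring n) → Undirected G → IsColoring π₀ →
    (G' : Graph n) (π' : Coloring n) →
    Canon.Derivable _<H_ hash _<G_ G π₀ (canon G' π') →
    Canon.IsCanonicalForm _<H_ hash _<G_ G π₀ G' π'
theorem4p14 _<H_ <H-sto hash hash-invariant _<G_ <G-sto G π₀ undirected π₀-isColoring G' π' derivation =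
  Soundness.sound _<H_ <H-sto hash hash-invariant _<G_ <G-sto G π₀ undirected π₀-isColoring derivation
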